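{- Let $n\ge2$ and $\gamma\in D_n$. Then, as formal power series in $t$, $$\sum_{f\in\mathbb{Z}^n_e:\ \pi(f)=\gamma}t^{\max(f)}q^{\max(f)\cdot n-|f|}=\frac{D^\gamma_n(t,q)}{(t;q)_n},$$ where $D_n^\gamma(t,q)=t^{\mathrm{des}_D(\gamma)+1}q^{\mathrm{maj}(\gamma)}$ if $\gamma\in D_n^+$, $D_n^\gamma(t,q)=t^{\mathrm{des}_D(\gamma)-1}q^{\mathrm{maj}(\gamma)}$ if $\gamma\in D_n^-$, and $D_n^\gamma(t,q)=t^{\mathrm{des}_D(\gamma)}q^{\mathrm{maj}(\gamma)}$ if $\gamma\in D_n^0$.
   Context: $B_n$ is the group of signed permutations of $[n]$ (bijections $\beta$ of $[-n,n]\setminus\{0\}$ with $\beta(-i)=-\beta(i)$), written $\beta=[\beta(1),\dots,\beta(n)]$; $D_n=\{\gamma\in B_n:|\{i:\gamma(i)<0\}|\text{ even}\}$. $\mathrm{Des}_B(\gamma)=\{i\in[0,n-1]:\gamma(i)>\gamma(i+1)\}$ with $\gamma(0):=0$ (natural order on integers), and $\mathrm{maj}(\gamma)=\sum_{i\in\mathrm{Des}_B(\gamma)}i$. $\mathrm{Des}_D(\gamma)=\{i\in[0,n-1]:\gamma(i)>\gamma(i+1)\}$ with the convention $\gamma(0):=-\gamma(2)$, and $\mathrm{des}_D(\gamma)=|\mathrm{Des}_D(\gamma)|$. $D_n^+=\{\gamma\in D_n:0\notin\mathrm{Des}_D(\gamma),\ \gamma(1)<0\}$, $D_n^-=\{\gamma\in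 D_n:0\in\mathrm{Des}_D(\gamma),\ \gamma(1)>0\}$, $D_n^0=D_n\setminus(D_n^+\cup D_n^-)$. For $f\in\mathbb{Z}^n$, $\max(f)=\max_i|f_i|$, $|f|=\sum_i|f_i|$, and $\pi(f)\in B_n$ is the unique $\beta$ with: (1) $|f_{|\beta(1)|}|\le\dots\le|f_{|\beta(n)|}|$; (2) $\beta(i)<0$ iff $f_{|\beta(i)|}<0$; (3) if $|f_{|\beta(i)|}|=|f_{|\beta(i+1)|}|$ then $\beta(i)<\beta(i+1)$. $\mathbb{Z}^n_e$ is the set of $f\in\mathbb{Z}^n$ with an even number of negative entries. $(t;q)_n=(1-t)(1-tq)\cdots(1-tq^{n-1})$. -}

module Defs where

open import Data.Bool using (Bool; true; false; _∧_; _∨_; not; if_then_else_)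
open import Data.Nat as ℕ using (ℕ; zero; suc; _∸_; _⊔_; _≡ᵇ_; _%_)
open import Data.Integer as ℤ using (ℤ; +_; -[1+_]; ∣_∣; -_)
open import Data.Nat.ListAction using (sum)
open import Data.List using (List; []; _∷_; map; filter; length; upTo; foldr; concatMap; _++_; filterᵇ)
open import Data.Bool.ListAction using (and)
open import Data.List.Relation.Unary.All using (All)
open import Data.List.Relation.Unary.Unique.Propositional using (Unique)
open import Data.Vec using (Vec; []; _∷_; toList)
open import Data.Product using (_×_)
open import Relation.Nullary.Decidable using (⌊_⌋)

-- Elements of B_n / D_n are window notations γ = [γ(1),…,γ(n)] : Vec ℤ n.

nth : List ℤ → ℕ → ℤ
nth []       _       = + 0
nth (x ∷ _)  zero    = x
nth (_ ∷ xs) (suc i) = nth xs i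

-- γ(i) for i ≥ 1, with γ(0) := 0
val : ∀ {n} → Vec ℤ n → ℕ → ℤ
val γ zero    = + 0
val γ (suc i) = nth (toList γ) i

infix 4 _<ᶻ_ _≤ᶻ_ _==ᶻ_ _==ᵇ_

_<ᶻ_ : ℤ → ℤ → Bool
x <ᶻ y = ⌊ x ℤ.<? y ⌋

_≤ᶻ_ : ℤ → ℤ → Bool
x ≤ᶻ y = ⌊ x ℤ.≤? y ⌋

_==ᶻ_ : ℤ → ℤ → Bool
x ==ᶻ y = ⌊ x ℤ.≟ y ⌋

_==ᵇ_ : Bool → Bool → Bool
true  ==ᵇ b = b
false ==ᵇ b = not b

negCount : List ℤ → ℕ
negCount xs = length (filter (λ x → x ℤ.<? + 0) xs)

InB : (n : ℕ) → Vec ℤ n → Set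
InB n γ = All (λ x → (1 ℕ.≤ ∣ x ∣) × (∣ x ∣ ℕ.≤ n)) (toList γ)
        × Unique (map ∣_∣ (toList γ))

InD : (n : ℕ) → Vec ℤ n → Set
InD n γ = InB n γ × (negCount (toList γ) % 2 ≡ 0)
  where open import Relation.Binary.PropositionalEquality using (_≡_)

DesB : ∀ {n} → Vec ℤ n → List ℕ
DesB {n} γ = filter (λ i → val γ (suc i) ℤ.<? val γ i) (upTo n)

maj : ∀ {n} → Vec ℤ n → ℕ
maj γ = sum (DesB γ)

-- γ(i) with the type-D convention γ(0) := -γ(2)
valD : ∀ {n} → Vec ℤ n → ℕ → ℤ
valD γ zero    = - val γ 2
valD γ (suc i) = val γ (suc i)

DesD : ∀ {n} → Vec ℤ n → List ℕ
DesD {n} γ = filter (λ i → valD γ (suc i) ℤ.<? valD γ i) (upTo n)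

desD : ∀ {n} → Vec ℤ n → ℕ
desD γ = length (DesD γ)

zeroInDesD : ∀ {n} → Vec ℤ n → Bool
zeroInDesD γ = valD γ 1 <ᶻ valD γ 0

inDplus : ∀ {n} → Vec ℤ n → Bool
inDplus γ = not (zeroInDesD γ) ∧ (val γ 1 <ᶻ + 0)

inDminus : ∀ {n} → Vec ℤ n → Bool
inDminus γ = zeroInDesD γ ∧ (+ 0 <ᶻ val γ 1)

maxAbs : ∀ {n} → Vec ℤ n → ℕ
maxAbs f = foldr (λ x r → ∣ x ∣ ⊔ r) 0 (toList f)

absSum : ∀ {n} → Vec ℤ n → ℕ
absSum f = sum (map ∣_∣ (toList f))

evenNeg : ∀ {n} → Vec ℤ n → Bool
evenNeg f = negCount (toList f) % 2 ≡ᵇ 0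

-- π(f) = β : β satisfies the three defining conditions (1),(2),(3) of π(f)
-- (π(f) is by definition the unique β ∈ B_n satisfying them)
piIs : ∀ {n} → Vec ℤ n → Vec ℤ n → Bool
piIs {n} β f = and (map c1 inner) ∧ and (map c2 (map suc (upTo n))) ∧ and (map c3 inner)
  where
  inner : List ℕ
  inner = map suc (upTo (n ∸ 1))
  F : ℕ → ℤ
  F i = nth (toList f) (∣ val β i ∣ ∸ 1)
  c1 : ℕ → Bool
  c1 i = ∣ F i ∣ ℕ.≤ᵇ ∣ F (suc i) ∣
  c2 : ℕ → Bool
  c2 i = (val β i <ᶻ + 0) ==ᵇ (F i <ᶻ + 0)
  c3 : ℕ → Bool
  c3 i = not (∣ F i ∣ ≡ᵇ ∣ F (suc i) ∣) ∨ (val β i <ᶻ val β (suc i))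

boundedVecs : (m n : ℕ) → List (Vec ℤ n)
boundedVecs m zero    = [] ∷ []
boundedVecs m (suc n) =
  concatMap (λ x → map (x ∷_) (boundedVecs m n)) (range m)
  where
  range : ℕ → List ℤ
  range m = map +_ (upTo (suc m)) ++ map -[1+_] (upTo m)

-- Formal power series in t, q over ℤ:  S a b = coefficient of t^a q^b

Series : Set
Series = ℕ → ℕ → ℤ

mono : ℕ → ℕ → Series
mono a b i j = if (i ≡ᵇ a) ∧ (j ≡ᵇ b) then + 1 else + 0

_⊝_ : Series → Series → Series
(A ⊝ B) i j = A i j ℤ.- B i j

_⋆_ : Series → Series → Series
(A ⋆ B) a b =
  foldr ℤ._+_ (+ 0)
    (concatMap (λ i → map (λ j → A i j ℤ.* B (a ∸ i) (b ∸ j)) (upTo (suc b)))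
               (upTo (suc a)))

tqPoch : ℕ → Series
tqPoch n = foldr (λ i S → (mono 0 0 ⊝ mono 1 i) ⋆ S) (mono 0 0) (upTo n)

-- LHS:  Σ_{f ∈ ℤ^n_e, π(f)=γ} t^{max f} q^{max(f)·n - |f|}
-- coefficient of t^m q^j = #{ f : max f = m, … , m·n - |f| = j }
lhsSeries : (n : ℕ) → Vec ℤ n → Series
lhsSeries n γ m j =
  + length (filterᵇ (λ f → (maxAbs f ≡ᵇ m) ∧ evenNeg f ∧ piIs γ f
                          ∧ ((m ℕ.* n ∸ absSum f) ≡ᵇ j))
                   (boundedVecs m n))

Dgamma : ∀ {n} → Vec ℤ n → Series
Dgamma γ =
  mono (if inDplus γ then suc (desD γ)
        else if inDminus γ then desD γ ∸ 1
        else desD γ)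
       (maj γ)

module Submission where

-- Proof of Lemma 6.2.  Fix γ ∈ D_n and put λ_p = |f_{|γ(p+1)|}| for p < n.  The
-- conditions π(f) = γ say that λ is weakly increasing, that f has the signs of γ,
-- and that λ increases strictly at every B-descent p ≥ 1 of γ (and λ_0 ≥ 1 when
-- γ(1) < 0, i.e. when 0 ∈ Des_B γ).  Passing to differences d_p = λ_p - λ_{p-1}
-- gives a bijection between the f counted by the coefficient of t^m q^j on the
-- left and the sequences d ∈ ℕⁿ with d_p ≥ ε_p := [p ∈ Des_B γ], Σ d_p = m and
-- Σ p·d_p = j (Abel summation turns m·n - |f| into Σ p·d_p; the parity condition
-- is automatic since f and γ have the same negative positions).  These sequences
-- are counted by Π_p t^{ε_p} q^{p ε_p} / (1 - t q^p), so multiplying by (t;q)_n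
-- leaves t^{des_B γ} q^{maj γ}, and des_B γ is the exponent of t in D_n^γ.

open import Defs
open import Data.Nat using (ℕ; _≤_)
open import Data.Integer using (ℤ)
open import Data.Vec using (Vec)
open import Relation.Binary.PropositionalEquality using (_≡_)

open import Data.Bool using (Bool; true; false; T; T?; _∧_; _∨_; not; if_then_else_)
open import Data.Bool.ListAction using (and)
open import Data.Bool.Properties using (T-∧; T-∨)
open import Data.Empty using (⊥; ⊥-elim)
open import Data.Unit using (tt)
open import Data.Nat as ℕ using (zero; suc; _∸_; _≡ᵇ_; _<_; z≤n; s≤s; _⊔_; _%_)
import Data.Nat.Properties as ℕP
open import Data.Nat.ListAction using (sum)
open import Data.Nat.ListAction.Properties using (sum-↭)
open import Data.Nat.Tactic.RingSolver using () renaming (solve-∀ to solve-ℕ)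
open import Data.Integer as ℤ using (+_; -[1+_]; ∣_∣; -_; _+_; _*_; _-_)
import Data.Integer.Properties as ℤP
open import Data.Integer.Tactic.RingSolver using (solve-∀)
open import Data.List using (List; []; _∷_; map; foldr; concatMap; _++_; applyUpTo; upTo; length; filter; filterᵇ; cartesianProductWith)
open import Data.List.Properties using (foldr-++; length-++; length-map; length-upTo; map-applyUpTo; map-upTo; map-∘)
open import Data.List.Membership.Propositional using (_∈_)
open import Data.List.Membership.Propositional.Properties
  using (∈-map⁻; ∈-map⁺; ∈-++⁻; ∈-++⁺ˡ; ∈-++⁺ʳ; ∈-upTo⁺; ∈-upTo⁻; ∈-∃++; ∈-filter⁺; ∈-filter⁻; ∈-cartesianProductWith⁺)
open import Data.List.Membership.Propositional.Properties.WithK using (unique∧set⇒bag)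
open import Data.List.Membership.DecPropositional ℕP._≟_ using (_∈?_)
open import Data.List.Relation.Unary.Any using (here; there)
open import Data.List.Relation.Unary.All as All using (All; []; _∷_)
import Data.List.Relation.Unary.All.Properties as AllP
open import Data.List.Relation.Unary.AllPairs using ([]; _∷_)
open import Data.List.Relation.Unary.Unique.Propositional using (Unique)
import Data.List.Relation.Unary.Unique.Propositional.Properties as Unique
open import Data.List.Relation.Binary.Permutation.Propositional using (_↭_; ↭-sym; ↭-trans; ↭-reflexive)
import Data.List.Relation.Binary.Permutation.Propositional.Properties as Perm
open import Data.List.Relation.Binary.BagAndSetEquality using (∼bag⇒↭)
open import Data.Vec using ([]; _∷_; toList)
open import Data.Vec.Properties using (length-toList; toList-injective)
open import Data.Vec.Relation.Binary.Equality.Cast using (cast-is-id)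
open import Data.Product using (Σ; _×_; _,_; proj₁; proj₂)
open import Data.Sum using (inj₁; inj₂)
open import Function.Bundles using (Equivalence; mk⇔)
open import Relation.Binary.PropositionalEquality using (refl; sym; trans; cong; cong₂; subst; subst₂; module ≡-Reasoning)
open import Relation.Nullary using (¬_; Dec; yes; no)
open import Relation.Nullary.Decidable using (⌊_⌋; toWitness; fromWitness)

open ≡-Reasoning

Σ< : ℕ → (ℕ → ℤ) → ℤ
Σ< zero    f = + 0
Σ< (suc n) f = f 0 + Σ< n (λ i → f (suc i))

Σ<-cong : ∀ n {f g : ℕ → ℤ} → (∀ i → i < n → f i ≡ g i) → Σ< n f ≡ Σ< n g
Σ<-cong zero    e = refl
Σ<-cong (suc n) e = cong₂ _+_ (e 0 (s≤s z≤n)) (Σ<-cong n (λ i i<n → e (suc i) (s≤s i<n)))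

Σ<-ext : ∀ n {f g : ℕ → ℤ} → (∀ i → f i ≡ g i) → Σ< n f ≡ Σ< n g
Σ<-ext n e = Σ<-cong n (λ i _ → e i)

Σ<-zero : ∀ n (f : ℕ → ℤ) → (∀ i → i < n → f i ≡ + 0) → Σ< n f ≡ + 0
Σ<-zero zero    f e = refl
Σ<-zero (suc n) f e = cong₂ _+_ (e 0 (s≤s z≤n)) (Σ<-zero n _ (λ i i<n → e (suc i) (s≤s i<n)))

Σ<-last : ∀ n (f : ℕ → ℤ) → Σ< (suc n) f ≡ Σ< n f + f n
Σ<-last zero    f = trans (ℤP.+-identityʳ (f 0)) (sym (ℤP.+-identityˡ (f 0)))
Σ<-last (suc n) f = trans (cong (_+_ (f 0)) (Σ<-last n (λ i → f (suc i))))
                          (sym (ℤP.+-assoc (f 0) _ _))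

Σ<-sub : ∀ n (f g : ℕ → ℤ) → Σ< n (λ i → f i - g i) ≡ Σ< n f - Σ< n g
Σ<-sub zero    f g = refl
Σ<-sub (suc n) f g = trans (cong (_+_ (f 0 - g 0)) (Σ<-sub n _ _)) (interchange (f 0) (g 0) _ _)
  where
  interchange : ∀ a b c d → (a - b) + (c - d) ≡ (a + c) - (b + d)
  interchange = solve-∀

Σ<-only-last : ∀ n (f : ℕ → ℤ) → (∀ i → i < n → f i ≡ + 0) → Σ< (suc n) f ≡ f n
Σ<-only-last n f e = begin
  Σ< (suc n) f    ≡⟨ Σ<-last n f ⟩
  Σ< n f + f n    ≡⟨ cong (_+ f n) (Σ<-zero n f e) ⟩
  + 0 + f n       ≡⟨ ℤP.+-identityˡ (f n) ⟩
  f n             ∎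

Σ<-only-first : ∀ n (f : ℕ → ℤ) → (∀ i → f (suc i) ≡ + 0) → Σ< (suc n) f ≡ f 0
Σ<-only-first n f e = trans (cong (_+_ (f 0)) (Σ<-zero n _ (λ i _ → e i))) (ℤP.+-identityʳ (f 0))

_≗ˢ_ : Series → Series → Set
A ≗ˢ B = ∀ i j → A i j ≡ B i j

𝟙 : Series
𝟙 = mono 0 0

conv : Series → Series → ℕ → ℕ → ℤ
conv A B a b = Σ< (suc a) (λ i → Σ< (suc b) (λ j → A i j * B (a ∸ i) (b ∸ j)))

foldr+-map : (k : ℕ → ℤ) (h : ℕ → ℕ) (n : ℕ) →
  foldr _+_ (+ 0) (map k (applyUpTo h n)) ≡ Σ< n (λ i → k (h i))
foldr+-map k h zero    = refl
foldr+-map k h (suc n) = cong (_+_ (k (h 0))) (foldr+-map k (λ i → h (suc i)) n)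

foldr+-concatMap : (g : ℕ → List ℤ) (h : ℕ → ℕ) (n : ℕ) →
  foldr _+_ (+ 0) (concatMap g (applyUpTo h n)) ≡ Σ< n (λ i → foldr _+_ (+ 0) (g (h i)))
foldr+-concatMap g h zero    = refl
foldr+-concatMap g h (suc n) = begin
  foldr _+_ (+ 0) (g (h 0) ++ rest)              ≡⟨ foldr-++ _+_ (+ 0) (g (h 0)) rest ⟩
  foldr _+_ (foldr _+_ (+ 0) rest) (g (h 0))     ≡⟨ foldr-from (g (h 0)) _ ⟩
  foldr _+_ (+ 0) (g (h 0)) + foldr _+_ (+ 0) rest
    ≡⟨ cong (_+_ (foldr _+_ (+ 0) (g (h 0)))) (foldr+-concatMap g (λ i → h (suc i)) n) ⟩
  Σ< (suc n) (λ i → foldr _+_ (+ 0) (g (h i)))   ∎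
  where
  rest : List ℤ
  rest = concatMap g (applyUpTo (λ i → h (suc i)) n)
  foldr-from : ∀ xs b → foldr _+_ b xs ≡ foldr _+_ (+ 0) xs + b
  foldr-from []       b = sym (ℤP.+-identityˡ b)
  foldr-from (x ∷ xs) b = trans (cong (_+_ x) (foldr-from xs b)) (sym (ℤP.+-assoc x _ b))

⋆-conv : ∀ A B a b → (A ⋆ B) a b ≡ conv A B a b
⋆-conv A B a b =
  trans (foldr+-concatMap (λ i → map (term i) (upTo (suc b))) (λ i → i) (suc a))
        (Σ<-ext (suc a) (λ i → foldr+-map (term i) (λ j → j) (suc b)))
  where
  term : ℕ → ℕ → ℤ
  term i j = A i j * B (a ∸ i) (b ∸ j)

delay : ℕ → (ℕ → ℤ) → ℕ → ℤ
delay zero    h x       = h x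
delay (suc p) h zero    = + 0
delay (suc p) h (suc x) = delay p h x

delay-cong : ∀ p {h h' : ℕ → ℤ} x → (∀ y → h y ≡ h' y) → delay p h x ≡ delay p h' x
delay-cong zero    x       e = e x
delay-cong (suc p) zero    e = refl
delay-cong (suc p) (suc x) e = delay-cong p x e

delay-delay : ∀ p p' (h : ℕ → ℤ) x → delay p (delay p' h) x ≡ delay (p ℕ.+ p') h x
delay-delay zero    p' h x       = refl
delay-delay (suc p) p' h zero    = refl
delay-delay (suc p) p' h (suc x) = delay-delay p p' h x

delay-zero : ∀ p x → delay p (λ _ → + 0) x ≡ + 0
delay-zero zero    x       = refl
delay-zero (suc p) zero    = refl
delay-zero (suc p) (suc x) = delay-zero p x

delay-swap : ∀ r p (H : ℕ → ℕ → ℤ) i j →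
  delay r (λ j' → delay p (λ i' → H i' j') i) j ≡ delay p (λ i' → delay r (H i') j) i
delay-swap zero    p H i j       = refl
delay-swap (suc r) p H i zero    = sym (delay-zero p i)
delay-swap (suc r) p H i (suc j) = delay-swap r p H i j

delay-sub : ∀ p (f g : ℕ → ℤ) x → delay p (λ y → f y - g y) x ≡ delay p f x - delay p g x
delay-sub zero    f g x       = refl
delay-sub (suc p) f g zero    = refl
delay-sub (suc p) f g (suc x) = delay-sub p f g x

Σ<-delay : ∀ n p (K : ℕ → ℕ → ℤ) x →
  Σ< n (λ i → delay p (K i) x) ≡ delay p (λ x' → Σ< n (λ i → K i x')) x
Σ<-delay n zero    K x       = refl
Σ<-delay n (suc p) K zero    = Σ<-zero n _ (λ _ _ → refl)
Σ<-delay n (suc p) K (suc x) = Σ<-delay n p K x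

*-delay : ∀ c p h x → c * delay p h x ≡ delay p (λ x' → c * h x') x
*-delay c zero    h x       = refl
*-delay c (suc p) h zero    = ℤP.*-zeroʳ c
*-delay c (suc p) h (suc x) = *-delay c p h x

delay-* : ∀ c p h x → delay p h x * c ≡ delay p (λ x' → h x' * c) x
delay-* c zero    h x       = refl
delay-* c (suc p) h zero    = ℤP.*-zeroˡ c
delay-* c (suc p) h (suc x) = delay-* c p h x

Σ<-antidiagonal-delayʳ : ∀ p a (K : ℕ → ℕ → ℤ) →
  Σ< (suc a) (λ i → delay p (K i) (a ∸ i)) ≡ delay p (λ a' → Σ< (suc a') (λ i → K i (a' ∸ i))) a
Σ<-antidiagonal-delayʳ zero    a       K = refl
Σ<-antidiagonal-delayʳ (suc p) zero    K = refl
Σ<-antidiagonal-delayʳ (suc p) (suc a) K = begin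
  Σ< (suc (suc a)) (λ i → delay (suc p) (K i) (suc a ∸ i))
    ≡⟨ Σ<-last (suc a) (λ i → delay (suc p) (K i) (suc a ∸ i)) ⟩
  Σ< (suc a) (λ i → delay (suc p) (K i) (suc a ∸ i)) + delay (suc p) (K (suc a)) (suc a ∸ suc a)
    ≡⟨ cong₂ _+_ (Σ<-cong (suc a) (λ i i≤a → cong (delay (suc p) (K i)) (ℕP.+-∸-assoc 1 (ℕP.≤-pred i≤a))))
                 (cong (delay (suc p) (K (suc a))) (ℕP.n∸n≡0 a)) ⟩
  Σ< (suc a) (λ i → delay p (K i) (a ∸ i)) + + 0
    ≡⟨ ℤP.+-identityʳ _ ⟩
  Σ< (suc a) (λ i → delay p (K i) (a ∸ i))
    ≡⟨ Σ<-antidiagonal-delayʳ p a K ⟩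
  delay p (λ a' → Σ< (suc a') (λ i → K i (a' ∸ i))) a ∎

Σ<-antidiagonal-delayˡ : ∀ p a (K : ℕ → ℕ → ℤ) →
  Σ< (suc a) (λ i → delay p (λ i' → K i' (a ∸ i)) i) ≡ delay p (λ a' → Σ< (suc a') (λ i → K i (a' ∸ i))) a
Σ<-antidiagonal-delayˡ zero    a       K = refl
Σ<-antidiagonal-delayˡ (suc p) zero    K = refl
Σ<-antidiagonal-delayˡ (suc p) (suc a) K = trans (ℤP.+-identityˡ _) (Σ<-antidiagonal-delayˡ p a K)

-- shift p r X = t^p q^r · X.

shift : ℕ → ℕ → Series → Series
shift p r X i j = delay p (λ i' → delay r (X i') j) i

shift-cong : ∀ p r {X Y} → X ≗ˢ Y → shift p r X ≗ˢ shift p r Y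
shift-cong p r e i j = delay-cong p i (λ i' → delay-cong r j (λ j' → e i' j'))

shift-shift : ∀ p r p' r' X → shift p r (shift p' r' X) ≗ˢ shift (p ℕ.+ p') (r ℕ.+ r') X
shift-shift p r p' r' X i j = begin
  delay p (λ i' → delay r (λ j' → delay p' (λ i'' → delay r' (X i'') j') i') j) i
    ≡⟨ delay-cong p i (λ i' → delay-swap r p' (λ i'' j' → delay r' (X i'') j') i' j) ⟩
  delay p (delay p' (λ i'' → delay r (delay r' (X i'')) j)) i
    ≡⟨ delay-cong p i (λ i' → delay-cong p' i' (λ i'' → delay-delay r r' (X i'') j)) ⟩
  delay p (delay p' (λ i'' → delay (r ℕ.+ r') (X i'') j)) i
    ≡⟨ delay-delay p p' (λ i'' → delay (r ℕ.+ r') (X i'') j) i ⟩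
  shift (p ℕ.+ p') (r ℕ.+ r') X i j ∎

shift-sub : ∀ p r X Y → shift p r (X ⊝ Y) ≗ˢ (shift p r X ⊝ shift p r Y)
shift-sub p r X Y i j =
  trans (delay-cong p i (λ i' → delay-sub r (X i') (Y i') j))
        (delay-sub p (λ i' → delay r (X i') j) (λ i' → delay r (Y i') j) i)

mono≗shift : ∀ p r → mono p r ≗ˢ shift p r 𝟙
mono≗shift zero    r i       j = q-part r j (i ≡ᵇ 0)
  where
  q-part : ∀ r j (c : Bool) →
    (if c ∧ (j ≡ᵇ r) then + 1 else + 0) ≡ delay r (λ j' → if c ∧ (j' ≡ᵇ 0) then + 1 else + 0) j
  q-part zero    j       c     = refl
  q-part (suc r) zero    false = refl
  q-part (suc r) zero    true  = refl
  q-part (suc r) (suc j) c     = q-part r j c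
mono≗shift (suc p) r zero    j = refl
mono≗shift (suc p) r (suc i) j = mono≗shift p r i j

⋆-congˡ : ∀ {A A'} X → A ≗ˢ A' → (A ⋆ X) ≗ˢ (A' ⋆ X)
⋆-congˡ {A} {A'} X e a b = begin
  (A ⋆ X) a b    ≡⟨ ⋆-conv A X a b ⟩
  conv A X a b   ≡⟨ Σ<-ext (suc a) (λ i → Σ<-ext (suc b) (λ j → cong (_* X (a ∸ i) (b ∸ j)) (e i j))) ⟩
  conv A' X a b  ≡⟨ ⋆-conv A' X a b ⟨
  (A' ⋆ X) a b   ∎

⋆-congʳ : ∀ A {X X'} → X ≗ˢ X' → (A ⋆ X) ≗ˢ (A ⋆ X')
⋆-congʳ A {X} {X'} e a b = begin
  (A ⋆ X) a b    ≡⟨ ⋆-conv A X a b ⟩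
  conv A X a b   ≡⟨ Σ<-ext (suc a) (λ i → Σ<-ext (suc b) (λ j → cong (_*_ (A i j)) (e (a ∸ i) (b ∸ j)))) ⟩
  conv A X' a b  ≡⟨ ⋆-conv A X' a b ⟨
  (A ⋆ X') a b   ∎

⋆-identityˡ : ∀ X → (𝟙 ⋆ X) ≗ˢ X
⋆-identityˡ X a b = begin
  (𝟙 ⋆ X) a b                                      ≡⟨ ⋆-conv 𝟙 X a b ⟩
  conv 𝟙 X a b                                     ≡⟨ Σ<-only-first a (λ i → Σ< (suc b) (λ j → 𝟙 i j * X (a ∸ i) (b ∸ j)))
                                                         (λ i → Σ<-zero (suc b) _ (λ j _ → ℤP.*-zeroˡ (X (a ∸ suc i) (b ∸ j)))) ⟩
  Σ< (suc b) (λ j → 𝟙 0 j * X a (b ∸ j))           ≡⟨ Σ<-only-first b (λ j → 𝟙 0 j * X a (b ∸ j)) (λ j → ℤP.*-zeroˡ (X a (b ∸ suc j))) ⟩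
  + 1 * X a b                                      ≡⟨ ℤP.*-identityˡ (X a b) ⟩
  X a b                                            ∎

⋆-identityʳ : ∀ A → (A ⋆ 𝟙) ≗ˢ A
⋆-identityʳ A a b = begin
  (A ⋆ 𝟙) a b                                      ≡⟨ ⋆-conv A 𝟙 a b ⟩
  conv A 𝟙 a b                                     ≡⟨ Σ<-only-last a (λ i → Σ< (suc b) (λ j → A i j * 𝟙 (a ∸ i) (b ∸ j))) (λ i i<a → Σ<-zero (suc b) _ (λ j _ → off-t i j a i<a)) ⟩
  Σ< (suc b) (λ j → A a j * 𝟙 (a ∸ a) (b ∸ j))     ≡⟨ Σ<-only-last b (λ j → A a j * 𝟙 (a ∸ a) (b ∸ j)) (λ j j<b → off-q j b j<b) ⟩
  A a b * 𝟙 (a ∸ a) (b ∸ b)                        ≡⟨ cong₂ (λ u v → A a b * 𝟙 u v) (ℕP.n∸n≡0 a) (ℕP.n∸n≡0 b) ⟩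
  A a b * + 1                                      ≡⟨ ℤP.*-identityʳ (A a b) ⟩
  A a b                                            ∎
  where
  off-t : ∀ i j a → i < a → A i j * 𝟙 (a ∸ i) (b ∸ j) ≡ + 0
  off-t i j (suc a) (s≤s i≤a) rewrite ℕP.+-∸-assoc 1 i≤a = ℤP.*-zeroʳ (A i j)
  off-q : ∀ j b → j < b → A a j * 𝟙 (a ∸ a) (b ∸ j) ≡ + 0
  off-q j (suc b) (s≤s j≤b) rewrite ℕP.n∸n≡0 a | ℕP.+-∸-assoc 1 j≤b = ℤP.*-zeroʳ (A a j)

⋆-distribˡ-⊝ : ∀ A X Y → (A ⋆ (X ⊝ Y)) ≗ˢ ((A ⋆ X) ⊝ (A ⋆ Y))
⋆-distribˡ-⊝ A X Y a b = begin
  (A ⋆ (X ⊝ Y)) a b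
    ≡⟨ ⋆-conv A (X ⊝ Y) a b ⟩
  Σ< (suc a) (λ i → Σ< (suc b) (λ j → A i j * (X (a ∸ i) (b ∸ j) - Y (a ∸ i) (b ∸ j))))
    ≡⟨ Σ<-ext (suc a) (λ i → trans (Σ<-ext (suc b) (λ j → distrib (A i j) (X (a ∸ i) (b ∸ j)) (Y (a ∸ i) (b ∸ j))))
                                    (Σ<-sub (suc b) (λ j → A i j * X (a ∸ i) (b ∸ j)) (λ j → A i j * Y (a ∸ i) (b ∸ j)))) ⟩
  Σ< (suc a) (λ i → Σ< (suc b) (λ j → A i j * X (a ∸ i) (b ∸ j)) - Σ< (suc b) (λ j → A i j * Y (a ∸ i) (b ∸ j)))
    ≡⟨ Σ<-sub (suc a) (λ i → Σ< (suc b) (λ j → A i j * X (a ∸ i) (b ∸ j))) (λ i → Σ< (suc b) (λ j → A i j * Y (a ∸ i) (b ∸ j))) ⟩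
  conv A X a b - conv A Y a b
    ≡⟨ cong₂ _-_ (⋆-conv A X a b) (⋆-conv A Y a b) ⟨
  (A ⋆ X) a b - (A ⋆ Y) a b ∎
  where
  distrib : ∀ a x y → a * (x - y) ≡ a * x - a * y
  distrib = solve-∀

⋆-distribʳ-⊝ : ∀ A B X → ((A ⊝ B) ⋆ X) ≗ˢ ((A ⋆ X) ⊝ (B ⋆ X))
⋆-distribʳ-⊝ A B X a b = begin
  ((A ⊝ B) ⋆ X) a b
    ≡⟨ ⋆-conv (A ⊝ B) X a b ⟩
  Σ< (suc a) (λ i → Σ< (suc b) (λ j → (A i j - B i j) * X (a ∸ i) (b ∸ j)))
    ≡⟨ Σ<-ext (suc a) (λ i → trans (Σ<-ext (suc b) (λ j → distrib (A i j) (B i j) (X (a ∸ i) (b ∸ j))))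
                                    (Σ<-sub (suc b) (λ j → A i j * X (a ∸ i) (b ∸ j)) (λ j → B i j * X (a ∸ i) (b ∸ j)))) ⟩
  Σ< (suc a) (λ i → Σ< (suc b) (λ j → A i j * X (a ∸ i) (b ∸ j)) - Σ< (suc b) (λ j → B i j * X (a ∸ i) (b ∸ j)))
    ≡⟨ Σ<-sub (suc a) (λ i → Σ< (suc b) (λ j → A i j * X (a ∸ i) (b ∸ j))) (λ i → Σ< (suc b) (λ j → B i j * X (a ∸ i) (b ∸ j))) ⟩
  conv A X a b - conv B X a b
    ≡⟨ cong₂ _-_ (⋆-conv A X a b) (⋆-conv B X a b) ⟨
  (A ⋆ X) a b - (B ⋆ X) a b ∎
  where
  distrib : ∀ x y a → (x - y) * a ≡ x * a - y * a
  distrib = solve-∀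

⋆-shiftʳ : ∀ A X p r → (A ⋆ shift p r X) ≗ˢ shift p r (A ⋆ X)
⋆-shiftʳ A X p r a b = begin
  (A ⋆ shift p r X) a b
    ≡⟨ ⋆-conv A (shift p r X) a b ⟩
  Σ< (suc a) (λ i → Σ< (suc b) (λ j → A i j * delay p (λ i' → delay r (X i') (b ∸ j)) (a ∸ i)))
    ≡⟨ Σ<-ext (suc a) (λ i →
         trans (Σ<-ext (suc b) (λ j → *-delay (A i j) p (λ i' → delay r (X i') (b ∸ j)) (a ∸ i)))
               (Σ<-delay (suc b) p (λ j i' → A i j * delay r (X i') (b ∸ j)) (a ∸ i))) ⟩
  Σ< (suc a) (λ i → delay p (λ i' → Σ< (suc b) (λ j → A i j * delay r (X i') (b ∸ j))) (a ∸ i))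
    ≡⟨ Σ<-antidiagonal-delayʳ p a (λ i i' → Σ< (suc b) (λ j → A i j * delay r (X i') (b ∸ j))) ⟩
  delay p (λ a' → Σ< (suc a') (λ i → Σ< (suc b) (λ j → A i j * delay r (X (a' ∸ i)) (b ∸ j)))) a
    ≡⟨ delay-cong p a (λ a' → trans (Σ<-ext (suc a') (λ i → inner a' i)) (Σ<-delay (suc a') r (λ i b' → Σ< (suc b') (λ j → A i j * X (a' ∸ i) (b' ∸ j))) b)) ⟩
  delay p (λ a' → delay r (conv A X a') b) a
    ≡⟨ shift-cong p r (λ a' b' → ⋆-conv A X a' b') a b ⟨
  shift p r (A ⋆ X) a b ∎
  where
  inner : ∀ a' i → Σ< (suc b) (λ j → A i j * delay r (X (a' ∸ i)) (b ∸ j))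
                 ≡ delay r (λ b' → Σ< (suc b') (λ j → A i j * X (a' ∸ i) (b' ∸ j))) b
  inner a' i = trans (Σ<-ext (suc b) (λ j → *-delay (A i j) r (X (a' ∸ i)) (b ∸ j)))
                     (Σ<-antidiagonal-delayʳ r b (λ j z → A i j * X (a' ∸ i) z))

⋆-shiftˡ : ∀ A X p r → (shift p r A ⋆ X) ≗ˢ shift p r (A ⋆ X)
⋆-shiftˡ A X p r a b = begin
  (shift p r A ⋆ X) a b
    ≡⟨ ⋆-conv (shift p r A) X a b ⟩
  Σ< (suc a) (λ i → Σ< (suc b) (λ j → delay p (λ i' → delay r (A i') j) i * X (a ∸ i) (b ∸ j)))
    ≡⟨ Σ<-ext (suc a) (λ i →
         trans (Σ<-ext (suc b) (λ j → delay-* (X (a ∸ i) (b ∸ j)) p (λ i' → delay r (A i') j) i))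
               (Σ<-delay (suc b) p (λ j i' → delay r (A i') j * X (a ∸ i) (b ∸ j)) i)) ⟩
  Σ< (suc a) (λ i → delay p (λ i' → Σ< (suc b) (λ j → delay r (A i') j * X (a ∸ i) (b ∸ j))) i)
    ≡⟨ Σ<-antidiagonal-delayˡ p a (λ i' x → Σ< (suc b) (λ j → delay r (A i') j * X x (b ∸ j))) ⟩
  delay p (λ a' → Σ< (suc a') (λ i → Σ< (suc b) (λ j → delay r (A i) j * X (a' ∸ i) (b ∸ j)))) a
    ≡⟨ delay-cong p a (λ a' → trans (Σ<-ext (suc a') (λ i → inner a' i)) (Σ<-delay (suc a') r (λ i b' → Σ< (suc b') (λ j → A i j * X (a' ∸ i) (b' ∸ j))) b)) ⟩
  delay p (λ a' → delay r (conv A X a') b) a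
    ≡⟨ shift-cong p r (λ a' b' → ⋆-conv A X a' b') a b ⟨
  shift p r (A ⋆ X) a b ∎
  where
  inner : ∀ a' i → Σ< (suc b) (λ j → delay r (A i) j * X (a' ∸ i) (b ∸ j))
                 ≡ delay r (λ b' → Σ< (suc b') (λ j → A i j * X (a' ∸ i) (b' ∸ j))) b
  inner a' i = trans (Σ<-ext (suc b) (λ j → delay-* (X (a' ∸ i) (b ∸ j)) r (A i) j))
                     (Σ<-antidiagonal-delayˡ r b (λ j' z → A i j' * X (a' ∸ i) z))

⋆-factor : ∀ w P → ((𝟙 ⊝ mono 1 w) ⋆ P) ≗ˢ (P ⊝ shift 1 w P)
⋆-factor w P a b = begin
  ((𝟙 ⊝ mono 1 w) ⋆ P) a b             ≡⟨ ⋆-distribʳ-⊝ 𝟙 (mono 1 w) P a b ⟩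
  (𝟙 ⋆ P) a b - (mono 1 w ⋆ P) a b     ≡⟨ cong₂ _-_ (⋆-identityˡ P a b) (⋆-congˡ P (mono≗shift 1 w) a b) ⟩
  P a b - (shift 1 w 𝟙 ⋆ P) a b        ≡⟨ cong (_-_ (P a b)) (⋆-shiftˡ 𝟙 P 1 w a b) ⟩
  P a b - shift 1 w (𝟙 ⋆ P) a b        ≡⟨ cong (_-_ (P a b)) (shift-cong 1 w (⋆-identityˡ P) a b) ⟩
  P a b - shift 1 w P a b              ∎

-- geomStep w ε R = R · t^ε q^{wε} / (1 - t q^w) = Σ_{d ≥ ε} t^d q^{wd} · R,
-- computed degree by degree in t.

geomStep : ℕ → ℕ → Series → Series
geomStep w ε R zero    j = shift ε (w ℕ.* ε) R zero j
geomStep w ε R (suc m) j = shift ε (w ℕ.* ε) R (suc m) j + delay w (geomStep w ε R m) j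

geomStep-telescope : ∀ w ε R → (geomStep w ε R ⊝ shift 1 w (geomStep w ε R)) ≗ˢ shift ε (w ℕ.* ε) R
geomStep-telescope w ε R zero    j = ℤP.+-identityʳ _
geomStep-telescope w ε R (suc m) j = cancel _ _
  where
  cancel : ∀ x y → (x + y) - y ≡ x
  cancel = solve-∀

-- For a list ps of pairs (w, ε), countSeries ps = Π_{(w,ε) ∈ ps} t^ε q^{wε} / (1 - t q^w);
-- its (m, j) coefficient counts the sequences (d_k) with d_k ≥ ε_k, Σ d_k = m, Σ w_k d_k = j.

countSeries : List (ℕ × ℕ) → Series
countSeries []             = 𝟙
countSeries ((w , ε) ∷ ps) = geomStep w ε (countSeries ps)

Σε : List (ℕ × ℕ) → ℕ
Σε []             = 0
Σε ((w , ε) ∷ ps) = ε ℕ.+ Σε ps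

Σwε : List (ℕ × ℕ) → ℕ
Σwε []             = 0
Σwε ((w , ε) ∷ ps) = w ℕ.* ε ℕ.+ Σwε ps

poch : List ℕ → Series
poch ws = foldr (λ w S → (𝟙 ⊝ mono 1 w) ⋆ S) 𝟙 ws

-- The generating-function identity: countSeries ps · Π (1 - t q^w) = t^{Σε} q^{Σwε}
-- (stated for t^p q^r · countSeries ps, to allow induction on ps).
countSeries-⋆-poch : ∀ ps p r →
  (shift p r (countSeries ps) ⋆ poch (map proj₁ ps)) ≗ˢ mono (p ℕ.+ Σε ps) (r ℕ.+ Σwε ps)
countSeries-⋆-poch [] p r a b = begin
  (shift p r 𝟙 ⋆ 𝟙) a b       ≡⟨ ⋆-identityʳ (shift p r 𝟙) a b ⟩
  shift p r 𝟙 a b             ≡⟨ mono≗shift p r a b ⟨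
  mono p r a b                ≡⟨ cong₂ (λ u v → mono u v a b) (ℕP.+-identityʳ p) (ℕP.+-identityʳ r) ⟨
  mono (p ℕ.+ 0) (r ℕ.+ 0) a b ∎
countSeries-⋆-poch ((w , ε) ∷ ps) p r a b = begin
  (A ⋆ ((𝟙 ⊝ mono 1 w) ⋆ P)) a b         ≡⟨ ⋆-congʳ A (⋆-factor w P) a b ⟩
  (A ⋆ (P ⊝ shift 1 w P)) a b            ≡⟨ ⋆-distribˡ-⊝ A P (shift 1 w P) a b ⟩
  (A ⋆ P) a b - (A ⋆ shift 1 w P) a b    ≡⟨ cong (_-_ ((A ⋆ P) a b)) (⋆-shiftʳ A P 1 w a b) ⟩
  (A ⋆ P) a b - shift 1 w (A ⋆ P) a b    ≡⟨ cong (_-_ ((A ⋆ P) a b)) (⋆-shiftˡ A P 1 w a b) ⟨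
  (A ⋆ P) a b - (shift 1 w A ⋆ P) a b    ≡⟨ ⋆-distribʳ-⊝ A (shift 1 w A) P a b ⟨
  ((A ⊝ shift 1 w A) ⋆ P) a b            ≡⟨ ⋆-congˡ P telescope a b ⟩
  (shift (p ℕ.+ ε) (r ℕ.+ w ℕ.* ε) (countSeries ps) ⋆ P) a b
                                         ≡⟨ countSeries-⋆-poch ps (p ℕ.+ ε) (r ℕ.+ w ℕ.* ε) a b ⟩
  mono (p ℕ.+ ε ℕ.+ Σε ps) (r ℕ.+ w ℕ.* ε ℕ.+ Σwε ps) a b
                                         ≡⟨ cong₂ (λ u v → mono u v a b) (ℕP.+-assoc p ε (Σε ps)) (ℕP.+-assoc r (w ℕ.* ε) (Σwε ps)) ⟩
  mono (p ℕ.+ (ε ℕ.+ Σε ps)) (r ℕ.+ (w ℕ.* ε ℕ.+ Σwε ps)) a b ∎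
  where
  G A P : Series
  G = geomStep w ε (countSeries ps)
  A = shift p r G
  P = poch (map proj₁ ps)
  telescope : (A ⊝ shift 1 w A) ≗ˢ shift (p ℕ.+ ε) (r ℕ.+ w ℕ.* ε) (countSeries ps)
  telescope i j = begin
    A i j - shift 1 w A i j
      ≡⟨ cong (_-_ (A i j)) (trans (shift-shift 1 w p r G i j)
                            (trans (cong₂ (λ u v → shift u v G i j) (ℕP.+-comm 1 p) (ℕP.+-comm w r))
                                   (sym (shift-shift p r 1 w G i j)))) ⟩
    A i j - shift p r (shift 1 w G) i j
      ≡⟨ shift-sub p r G (shift 1 w G) i j ⟨
    shift p r (G ⊝ shift 1 w G) i j
      ≡⟨ shift-cong p r (geomStep-telescope w ε (countSeries ps)) i j ⟩
    shift p r (shift ε (w ℕ.* ε) (countSeries ps)) i j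
      ≡⟨ shift-shift p r ε (w ℕ.* ε) (countSeries ps) i j ⟩
    shift (p ℕ.+ ε) (r ℕ.+ w ℕ.* ε) (countSeries ps) i j ∎

shiftList : {X : Set} → ℕ → (ℕ → List X) → ℕ → List X
shiftList zero    h x       = h x
shiftList (suc p) h zero    = []
shiftList (suc p) h (suc x) = shiftList p h x

length-shiftList : ∀ {X : Set} p (h : ℕ → List X) x →
  + length (shiftList p h x) ≡ delay p (λ y → + length (h y)) x
length-shiftList zero    h x       = refl
length-shiftList (suc p) h zero    = refl
length-shiftList (suc p) h (suc x) = length-shiftList p h x

∈-shiftList⁻ : ∀ {X : Set} p (h : ℕ → List X) x {d} → d ∈ shiftList p h x → Σ ℕ (λ y → x ≡ p ℕ.+ y × d ∈ h y)
∈-shiftList⁻ zero    h x       mem = x , refl , mem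
∈-shiftList⁻ (suc p) h (suc x) mem with ∈-shiftList⁻ p h x mem
... | y , refl , mem' = y , refl , mem'

∈-shiftList⁺ : ∀ {X : Set} p (h : ℕ → List X) y {d} → d ∈ h y → d ∈ shiftList p h (p ℕ.+ y)
∈-shiftList⁺ zero    h y mem = mem
∈-shiftList⁺ (suc p) h y mem = ∈-shiftList⁺ p h y mem

Unique-shiftList : ∀ {X : Set} p (h : ℕ → List X) x → (∀ y → Unique (h y)) → Unique (shiftList p h x)
Unique-shiftList zero    h x       u = u x
Unique-shiftList (suc p) h zero    u = []
Unique-shiftList (suc p) h (suc x) u = Unique-shiftList p h x u

bump : List ℕ → List ℕ
bump []      = []
bump (x ∷ d) = suc x ∷ d

bump-injective : ∀ {d e} → bump d ≡ bump e → d ≡ e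
bump-injective {[]}    {[]}    _    = refl
bump-injective {x ∷ d} {y ∷ e} refl = refl

-- Given R m j, the lists of sequences ε ∷ d' with d' ∈ R (m - ε) (j - wε) ...
headIs : ℕ → ℕ → (ℕ → ℕ → List (List ℕ)) → ℕ → ℕ → List (List ℕ)
headIs w ε R m j = shiftList ε (λ m' → shiftList (w ℕ.* ε) (λ j' → map (ε ∷_) (R m' j')) j) m

-- ... and the list counterpart of geomStep: all d₀ ∷ d' with ε ≤ d₀ and
-- d' ∈ R (m - d₀) (j - w d₀), sorted by d₀.
stepList : ℕ → ℕ → (ℕ → ℕ → List (List ℕ)) → ℕ → ℕ → List (List ℕ)
stepList w ε R zero    j = headIs w ε R zero j
stepList w ε R (suc m) j = headIs w ε R (suc m) j ++ shiftList w (λ j' → map bump (stepList w ε R m j')) j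

-- admissibles ps m j: the sequences counted by the coefficient (m, j) of countSeries ps.
admissibles : List (ℕ × ℕ) → ℕ → ℕ → List (List ℕ)
admissibles []             m j = if (m ≡ᵇ 0) ∧ (j ≡ᵇ 0) then [] ∷ [] else []
admissibles ((w , ε) ∷ ps)     = stepList w ε (admissibles ps)

length-admissibles : ∀ ps m j → + length (admissibles ps m j) ≡ countSeries ps m j
length-admissibles [] m j with (m ≡ᵇ 0) ∧ (j ≡ᵇ 0)
... | true  = refl
... | false = refl
length-admissibles ((w , ε) ∷ ps) = length-step
  where
  R : ℕ → ℕ → List (List ℕ)
  R = admissibles ps
  length-headIs : ∀ m j → + length (headIs w ε R m j) ≡ shift ε (w ℕ.* ε) (countSeries ps) m j
  length-headIs m j =
    trans (length-shiftList ε _ m) (delay-cong ε m (λ m' →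
      trans (length-shiftList (w ℕ.* ε) _ j) (delay-cong (w ℕ.* ε) j (λ j' →
        trans (cong +_ (length-map (ε ∷_) (R m' j'))) (length-admissibles ps m' j')))))
  length-step : ∀ m j → + length (stepList w ε R m j) ≡ geomStep w ε (countSeries ps) m j
  length-step zero    j = length-headIs 0 j
  length-step (suc m) j = begin
    + length (headIs w ε R (suc m) j ++ tl)
      ≡⟨ cong +_ (length-++ (headIs w ε R (suc m) j)) ⟩
    + (length (headIs w ε R (suc m) j) ℕ.+ length tl)
      ≡⟨ ℤP.pos-+ (length (headIs w ε R (suc m) j)) (length tl) ⟩
    + length (headIs w ε R (suc m) j) + + length tl
      ≡⟨ cong₂ _+_ (length-headIs (suc m) j)
           (trans (length-shiftList w _ j) (delay-cong w j (λ j' →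
              trans (cong +_ (length-map bump (stepList w ε R m j'))) (length-step m j')))) ⟩
    geomStep w ε (countSeries ps) (suc m) j ∎
    where
    tl : List (List ℕ)
    tl = shiftList w (λ j' → map bump (stepList w ε R m j')) j

record Extends (w ε : ℕ) (R : ℕ → ℕ → List (List ℕ)) (m j : ℕ) (d : List ℕ) : Set where
  constructor extends
  field
    first  : ℕ
    rest   : List ℕ
    m'     : ℕ
    j'     : ℕ
    d≡     : d ≡ first ∷ rest
    ε≤     : ε ≤ first
    m≡     : m ≡ first ℕ.+ m'
    j≡     : j ≡ w ℕ.* first ℕ.+ j'
    rest∈  : rest ∈ R m' j'

∈-headIs⁻ : ∀ w ε R m j {d} → d ∈ headIs w ε R m j →
  Σ (Extends w ε R m j d) (λ e → Extends.first e ≡ ε)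
∈-headIs⁻ w ε R m j mem with ∈-shiftList⁻ ε _ m mem
... | m' , m≡ , mem₁ with ∈-shiftList⁻ (w ℕ.* ε) _ j mem₁
... | j' , j≡ , mem₂ with ∈-map⁻ (ε ∷_) mem₂
... | d' , mem₃ , refl = extends ε d' m' j' refl ℕP.≤-refl m≡ j≡ mem₃ , refl

∈-stepList⁻ : ∀ w ε R m j {d} → d ∈ stepList w ε R m j → Extends w ε R m j d
∈-stepList⁻ w ε R zero    j mem = proj₁ (∈-headIs⁻ w ε R zero j mem)
∈-stepList⁻ w ε R (suc m) j mem with ∈-++⁻ (headIs w ε R (suc m) j) mem
... | inj₁ mem₁ = proj₁ (∈-headIs⁻ w ε R (suc m) j mem₁)
... | inj₂ mem₂ with ∈-shiftList⁻ w _ j mem₂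
... | j₀ , j≡ , mem₃ with ∈-map⁻ bump mem₃
... | e , mem₄ , refl with ∈-stepList⁻ w ε R m j₀ mem₄
... | extends d₀ d' m' j' refl ε≤ m≡ j₀≡ mem₅ =
  extends (suc d₀) d' m' j' refl (ℕP.m≤n⇒m≤1+n ε≤) (cong suc m≡) j≡' mem₅
  where
  j≡' : j ≡ w ℕ.* suc d₀ ℕ.+ j'
  j≡' = begin
    j                          ≡⟨ j≡ ⟩
    w ℕ.+ j₀                   ≡⟨ cong (w ℕ.+_) j₀≡ ⟩
    w ℕ.+ (w ℕ.* d₀ ℕ.+ j')    ≡⟨ ℕP.+-assoc w (w ℕ.* d₀) j' ⟨
    w ℕ.+ w ℕ.* d₀ ℕ.+ j'      ≡⟨ cong (ℕ._+ j') (ℕP.*-suc w d₀) ⟨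
    w ℕ.* suc d₀ ℕ.+ j'        ∎

∈-stepList⁺ : ∀ w ε R {d} m j → Extends w ε R m j d → d ∈ stepList w ε R m j
∈-stepList⁺ w ε R m j (extends d₀ d' m' j' refl ε≤ refl refl mem) with ℕP.m≤n⇒∃[o]m+o≡n ε≤
... | k , refl = go k
  where
  -- the element with first entry ε + k sits k steps down the recursion.
  go : ∀ k → (ε ℕ.+ k) ∷ d' ∈ stepList w ε R ((ε ℕ.+ k) ℕ.+ m') (w ℕ.* (ε ℕ.+ k) ℕ.+ j')
  go zero rewrite ℕP.+-identityʳ ε =
    headIs⊆stepList (ε ℕ.+ m') (∈-shiftList⁺ ε _ m' (∈-shiftList⁺ (w ℕ.* ε) _ j' (∈-map⁺ (ε ∷_) mem)))
    where
    headIs⊆stepList : ∀ m {j d} → d ∈ headIs w ε R m j → d ∈ stepList w ε R m j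
    headIs⊆stepList zero    mem = mem
    headIs⊆stepList (suc m) mem = ∈-++⁺ˡ mem
  go (suc k) rewrite ℕP.+-suc ε k | ℕP.*-suc w (ε ℕ.+ k) | ℕP.+-assoc w (w ℕ.* (ε ℕ.+ k)) j' =
    ∈-++⁺ʳ (headIs w ε R (suc (ε ℕ.+ k ℕ.+ m')) (w ℕ.+ (w ℕ.* (ε ℕ.+ k) ℕ.+ j')))
      (∈-shiftList⁺ w _ (w ℕ.* (ε ℕ.+ k) ℕ.+ j') (∈-map⁺ bump (go k)))

Unique-stepList : ∀ w ε R → (∀ m j → Unique (R m j)) → ∀ m j → Unique (stepList w ε R m j)
Unique-stepList w ε R uR = go
  where
  Unique-headIs : ∀ m j → Unique (headIs w ε R m j)
  Unique-headIs m j = Unique-shiftList ε _ m (λ m' → Unique-shiftList (w ℕ.* ε) _ j (λ j' →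
                        Unique.map⁺ (λ { refl → refl }) (uR m' j')))
  go : ∀ m j → Unique (stepList w ε R m j)
  go zero    j = Unique-headIs zero j
  go (suc m) j = Unique.++⁺ (Unique-headIs (suc m) j)
    (Unique-shiftList w _ j (λ j' → Unique.map⁺ bump-injective (go m j')))
    disjoint
    where
    -- the first block has first entry ε, the second block first entries > ε.
    disjoint : ∀ {d} → ¬ (d ∈ headIs w ε R (suc m) j × d ∈ shiftList w (λ j' → map bump (stepList w ε R m j')) j)
    disjoint (mem₁ , mem₂) with ∈-headIs⁻ w ε R (suc m) j mem₁ | ∈-shiftList⁻ w _ j mem₂
    ... | extends _ _ _ _ refl _ _ _ _ , refl | j₀ , _ , mem₃ with ∈-map⁻ bump mem₃
    ... | e , mem₄ , e≡ with ∈-stepList⁻ w ε R m j₀ mem₄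
    ... | extends _ _ _ _ refl ε≤ _ _ _ with e≡
    ... | refl = ℕP.<-irrefl refl (s≤s ε≤)

Unique-admissibles : ∀ ps m j → Unique (admissibles ps m j)
Unique-admissibles [] m j with (m ≡ᵇ 0) ∧ (j ≡ᵇ 0)
... | true  = [] ∷ []
... | false = []
Unique-admissibles ((w , ε) ∷ ps) = Unique-stepList w ε (admissibles ps) (Unique-admissibles ps)

entry : List ℕ → ℕ → ℕ
entry []      _       = 0
entry (x ∷ _) zero    = x
entry (_ ∷ d) (suc p) = entry d p

drop1 : List ℕ → List ℕ
drop1 []      = []
drop1 (_ ∷ d) = d

weightedSum : (ℕ → ℕ × ℕ) → ℕ → List ℕ → ℕ
weightedSum P zero    d = 0
weightedSum P (suc k) d = proj₁ (P 0) ℕ.* entry d 0 ℕ.+ weightedSum (λ p → P (suc p)) k (drop1 d)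

record Admissible (P : ℕ → ℕ × ℕ) (k : ℕ) (d : List ℕ) (m j : ℕ) : Set where
  field
    length≡   : length d ≡ k
    lower     : ∀ p → p < k → proj₂ (P p) ≤ entry d p
    sum≡      : sum d ≡ m
    weighted≡ : weightedSum P k d ≡ j

∈-admissibles⁻ : ∀ P k m j {d} → d ∈ admissibles (applyUpTo P k) m j → Admissible P k d m j
∈-admissibles⁻ P zero m j {d} mem with m ≡ᵇ 0 in m≡0 | j ≡ᵇ 0 in j≡0
∈-admissibles⁻ P zero m j {d} (here refl) | true | true = record
  { length≡ = refl ; lower = λ p () ; sum≡ = sym (ℕP.≡ᵇ⇒≡ m 0 (subst T (sym m≡0) tt))
  ; weighted≡ = sym (ℕP.≡ᵇ⇒≡ j 0 (subst T (sym j≡0) tt)) }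
∈-admissibles⁻ P (suc k) m j mem with ∈-stepList⁻ _ _ _ m j mem
... | extends d₀ d' m' j' refl ε≤ refl refl mem' = record
  { length≡ = cong suc (Admissible.length≡ adm') ; lower = lower
  ; sum≡ = cong (d₀ ℕ.+_) (Admissible.sum≡ adm')
  ; weighted≡ = cong (proj₁ (P 0) ℕ.* d₀ ℕ.+_) (Admissible.weighted≡ adm') }
  where
  adm' : Admissible (λ p → P (suc p)) k d' m' j'
  adm' = ∈-admissibles⁻ (λ p → P (suc p)) k m' j' mem'
  lower : ∀ p → p < suc k → proj₂ (P p) ≤ entry (d₀ ∷ d') p
  lower zero    _         = ε≤
  lower (suc p) (s≤s p<k) = Admissible.lower adm' p p<k

∈-admissibles⁺ : ∀ P k m j {d} → Admissible P k d m j → d ∈ admissibles (applyUpTo P k) m j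
∈-admissibles⁺ P zero    m j {[]}    record { sum≡ = refl ; weighted≡ = refl } = here refl
∈-admissibles⁺ P (suc k) m j {x ∷ d} adm =
  ∈-stepList⁺ _ _ _ m j (extends x d (sum d) (weightedSum (λ p → P (suc p)) k d) refl
    (Admissible.lower adm 0 (s≤s z≤n)) (sym (Admissible.sum≡ adm)) (sym (Admissible.weighted≡ adm))
    (∈-admissibles⁺ (λ p → P (suc p)) k (sum d) _ record
      { length≡ = ℕP.suc-injective (Admissible.length≡ adm)
      ; lower = λ p p<k → Admissible.lower adm (suc p) (s≤s p<k)
      ; sum≡ = refl ; weighted≡ = refl }))

prefix : List ℕ → ℕ → ℕ
prefix d       zero    = 0
prefix []      (suc p) = 0
prefix (y ∷ d) (suc p) = y ℕ.+ prefix d p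

prefix-suc : ∀ d p → prefix d (suc p) ≡ prefix d p ℕ.+ entry d p
prefix-suc []      zero    = refl
prefix-suc []      (suc p) = refl
prefix-suc (y ∷ d) zero    = ℕP.+-identityʳ y
prefix-suc (y ∷ d) (suc p) = trans (cong (y ℕ.+_) (prefix-suc d p)) (sym (ℕP.+-assoc y (prefix d p) (entry d p)))

prefix-length : ∀ d → prefix d (length d) ≡ sum d
prefix-length []      = refl
prefix-length (y ∷ d) = cong (y ℕ.+_) (prefix-length d)

prefix≤sum : ∀ d p → prefix d p ≤ sum d
prefix≤sum d       zero    = z≤n
prefix≤sum []      (suc p) = z≤n
prefix≤sum (y ∷ d) (suc p) = ℕP.+-monoʳ-≤ y (prefix≤sum d p)

prefix-mono : ∀ d p → prefix d p ≤ prefix d (suc p)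
prefix-mono d p = subst (prefix d p ≤_) (sym (prefix-suc d p)) (ℕP.m≤m+n (prefix d p) (entry d p))

prefix-injective : ∀ k d d' → length d ≡ k → length d' ≡ k →
  (∀ p → p < k → prefix d (suc p) ≡ prefix d' (suc p)) → d ≡ d'
prefix-injective zero    []      []        _ _  _ = refl
prefix-injective (suc k) (y ∷ e) (y' ∷ e') l l' h =
  cong₂ _∷_ y≡y' (prefix-injective k e e' (ℕP.suc-injective l) (ℕP.suc-injective l')
    (λ p p<k → ℕP.+-cancelˡ-≡ y _ _ (trans (h (suc p) (s≤s p<k)) (cong (ℕ._+ prefix e' (suc p)) (sym y≡y')))))
  where
  y≡y' : y ≡ y'
  y≡y' = trans (sym (ℕP.+-identityʳ y)) (trans (h 0 (s≤s z≤n)) (ℕP.+-identityʳ y'))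

differences : ℕ → (ℕ → ℕ) → ℕ → List ℕ
differences prev L zero    = []
differences prev L (suc k) = (L 0 ∸ prev) ∷ differences (L 0) (λ i → L (suc i)) k

difference : ℕ → (ℕ → ℕ) → ℕ → ℕ
difference prev L zero    = L 0 ∸ prev
difference prev L (suc p) = L (suc p) ∸ L p

length-differences : ∀ prev L k → length (differences prev L k) ≡ k
length-differences prev L zero    = refl
length-differences prev L (suc k) = cong suc (length-differences (L 0) (λ i → L (suc i)) k)

entry-differences : ∀ prev L k p → p < k → entry (differences prev L k) p ≡ difference prev L p
entry-differences prev L (suc k) zero          _       = refl
entry-differences prev L (suc k) (suc zero)    (s≤s lt) = entry-differences (L 0) (λ i → L (suc i)) k 0 lt
entry-differences prev L (suc k) (suc (suc p)) (s≤s lt) = entry-differences (L 0) (λ i → L (suc i)) k (suc p) lt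

prefix-differences : ∀ prev L k → prev ≤ L 0 → (∀ p → suc p < k → L p ≤ L (suc p)) →
  ∀ p → p < k → prefix (differences prev L k) (suc p) ℕ.+ prev ≡ L p
prefix-differences prev L (suc k) le mono zero _ =
  trans (cong (ℕ._+ prev) (ℕP.+-identityʳ (L 0 ∸ prev))) (ℕP.m∸n+n≡m le)
prefix-differences prev L (suc k) le mono (suc p) (s≤s lt) = begin
  (L 0 ∸ prev) ℕ.+ S ℕ.+ prev    ≡⟨ rearrange (L 0 ∸ prev) S prev ⟩
  (L 0 ∸ prev) ℕ.+ prev ℕ.+ S    ≡⟨ cong (ℕ._+ S) (ℕP.m∸n+n≡m le) ⟩
  L 0 ℕ.+ S                      ≡⟨ ℕP.+-comm (L 0) S ⟩
  S ℕ.+ L 0                      ≡⟨ prefix-differences (L 0) (λ i → L (suc i)) k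
                                      (mono 0 (s≤s (ℕP.≤-trans (s≤s z≤n) lt))) (λ q lt' → mono (suc q) (s≤s lt')) p lt ⟩
  L (suc p)                      ∎
  where
  S : ℕ
  S = prefix (differences (L 0) (λ i → L (suc i)) k) (suc p)
  rearrange : ∀ a b c → a ℕ.+ b ℕ.+ c ≡ a ℕ.+ c ℕ.+ b
  rearrange a b c = trans (ℕP.+-assoc a b c) (trans (cong (a ℕ.+_) (ℕP.+-comm b c)) (sym (ℕP.+-assoc a c b)))

indexWeighted : ℕ → List ℕ → ℕ
indexWeighted o []      = 0
indexWeighted o (y ∷ d) = o ℕ.* y ℕ.+ indexWeighted (suc o) d

indexWeighted-suc : ∀ o d → indexWeighted (suc o) d ≡ indexWeighted o d ℕ.+ sum d
indexWeighted-suc o []      = refl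
indexWeighted-suc o (y ∷ d) rewrite indexWeighted-suc (suc o) d = regroup o y (indexWeighted (suc o) d) (sum d)
  where
  regroup : ∀ o y w s → y ℕ.+ o ℕ.* y ℕ.+ (w ℕ.+ s) ≡ o ℕ.* y ℕ.+ w ℕ.+ (y ℕ.+ s)
  regroup = solve-ℕ

weightedSum≡indexWeighted : ∀ (P : ℕ → ℕ × ℕ) o k d → (∀ p → proj₁ (P p) ≡ o ℕ.+ p) → length d ≡ k →
  weightedSum P k d ≡ indexWeighted o d
weightedSum≡indexWeighted P o zero    []      e l = refl
weightedSum≡indexWeighted P o (suc k) (y ∷ d) e l =
  cong₂ ℕ._+_ (cong (ℕ._* y) (trans (e 0) (ℕP.+-identityʳ o)))
    (weightedSum≡indexWeighted (λ p → P (suc p)) (suc o) k d (λ p → trans (e (suc p)) (ℕP.+-suc o p)) (ℕP.suc-injective l))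

abel-summation : ∀ d → sum (applyUpTo (λ p → prefix d (suc p)) (length d)) ℕ.+ indexWeighted 0 d ≡ length d ℕ.* sum d
abel-summation []      = refl
abel-summation (y ∷ d) = begin
  y ℕ.+ 0 ℕ.+ sum (applyUpTo (λ p → y ℕ.+ prefix d (suc p)) k) ℕ.+ indexWeighted 1 d
    ≡⟨ cong₂ (λ u v → y ℕ.+ 0 ℕ.+ u ℕ.+ v) (sum-shifted (λ p → prefix d (suc p)) k) (indexWeighted-suc 0 d) ⟩
  y ℕ.+ 0 ℕ.+ (k ℕ.* y ℕ.+ Λ) ℕ.+ (indexWeighted 0 d ℕ.+ sum d)
    ≡⟨ regroup y k Λ (indexWeighted 0 d) (sum d) ⟩
  y ℕ.+ k ℕ.* y ℕ.+ (Λ ℕ.+ indexWeighted 0 d) ℕ.+ sum d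
    ≡⟨ cong (λ z → y ℕ.+ k ℕ.* y ℕ.+ z ℕ.+ sum d) (abel-summation d) ⟩
  y ℕ.+ k ℕ.* y ℕ.+ k ℕ.* sum d ℕ.+ sum d
    ≡⟨ collect y k (sum d) ⟩
  y ℕ.+ sum d ℕ.+ k ℕ.* (y ℕ.+ sum d) ∎
  where
  k Λ : ℕ
  k = length d
  Λ = sum (applyUpTo (λ p → prefix d (suc p)) k)
  sum-shifted : ∀ (g : ℕ → ℕ) k → sum (applyUpTo (λ p → y ℕ.+ g p) k) ≡ k ℕ.* y ℕ.+ sum (applyUpTo g k)
  sum-shifted g zero    = refl
  sum-shifted g (suc k) rewrite sum-shifted (λ p → g (suc p)) k = swap y (g 0) (k ℕ.* y) _
    where
    swap : ∀ y a b c → y ℕ.+ a ℕ.+ (b ℕ.+ c) ≡ y ℕ.+ b ℕ.+ (a ℕ.+ c)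
    swap = solve-ℕ
  regroup : ∀ y k s w t → y ℕ.+ 0 ℕ.+ (k ℕ.* y ℕ.+ s) ℕ.+ (w ℕ.+ t) ≡ y ℕ.+ k ℕ.* y ℕ.+ (s ℕ.+ w) ℕ.+ t
  regroup = solve-ℕ
  collect : ∀ y k t → y ℕ.+ k ℕ.* y ℕ.+ k ℕ.* t ℕ.+ t ≡ y ℕ.+ t ℕ.+ k ℕ.* (y ℕ.+ t)
  collect = solve-ℕ

levels-weight : ∀ d k m → length d ≡ k → sum d ≡ m →
  m ℕ.* k ∸ sum (applyUpTo (λ p → prefix d (suc p)) k) ≡ indexWeighted 0 d
levels-weight d _ _ refl refl = begin
  sum d ℕ.* length d ∸ S                           ≡⟨ cong (_∸ S) (ℕP.*-comm (sum d) (length d)) ⟩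
  length d ℕ.* sum d ∸ S                           ≡⟨ cong (_∸ S) (abel-summation d) ⟨
  S ℕ.+ indexWeighted 0 d ∸ S                      ≡⟨ ℕP.m+n∸m≡n S (indexWeighted 0 d) ⟩
  indexWeighted 0 d                                ∎
  where
  S : ℕ
  S = sum (applyUpTo (λ p → prefix d (suc p)) (length d))

nth-applyUpTo : ∀ (h : ℕ → ℤ) k p → p < k → nth (applyUpTo h k) p ≡ h p
nth-applyUpTo h (suc k) zero    _        = refl
nth-applyUpTo h (suc k) (suc p) (s≤s lt) = nth-applyUpTo (λ i → h (suc i)) k p lt

nth∈ : ∀ ys q → q < length ys → nth ys q ∈ ys
nth∈ (y ∷ ys) zero    _        = here refl
nth∈ (y ∷ ys) (suc q) (s≤s lt) = there (nth∈ ys q lt)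

applyUpTo-cong : ∀ {X : Set} (g h : ℕ → X) k → (∀ p → p < k → g p ≡ h p) → applyUpTo g k ≡ applyUpTo h k
applyUpTo-cong g h zero    e = refl
applyUpTo-cong g h (suc k) e =
  cong₂ _∷_ (e 0 (s≤s z≤n)) (applyUpTo-cong (λ i → g (suc i)) (λ i → h (suc i)) k (λ p lt → e (suc p) (s≤s lt)))

applyUpTo-nth : ∀ ys → ys ≡ applyUpTo (nth ys) (length ys)
applyUpTo-nth []       = refl
applyUpTo-nth (y ∷ ys) = cong (y ∷_) (applyUpTo-nth ys)

toList-tabulated : ∀ {n} (f : Vec ℤ n) → toList f ≡ applyUpTo (nth (toList f)) n
toList-tabulated f = trans (applyUpTo-nth (toList f)) (cong (applyUpTo (nth (toList f))) (length-toList f))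

vecOf : (n : ℕ) → (ℕ → ℤ) → Vec ℤ n
vecOf zero    h = []
vecOf (suc n) h = h 0 ∷ vecOf n (λ i → h (suc i))

toList-vecOf : ∀ n h → toList (vecOf n h) ≡ applyUpTo h n
toList-vecOf zero    h = refl
toList-vecOf (suc n) h = cong (h 0 ∷_) (toList-vecOf n (λ i → h (suc i)))

maxAbsList : List ℤ → ℕ
maxAbsList = foldr (λ x r → ∣ x ∣ ⊔ r) 0

maxAbs-upper : ∀ fs → All (λ x → ∣ x ∣ ≤ maxAbsList fs) fs
maxAbs-upper []       = []
maxAbs-upper (x ∷ fs) =
  ℕP.m≤m⊔n ∣ x ∣ (maxAbsList fs) ∷ All.map (λ le → ℕP.≤-trans le (ℕP.m≤n⊔m ∣ x ∣ (maxAbsList fs))) (maxAbs-upper fs)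

maxAbs-least : ∀ fs m → All (λ x → ∣ x ∣ ≤ m) fs → maxAbsList fs ≤ m
maxAbs-least []       m _        = z≤n
maxAbs-least (x ∷ fs) m (a ∷ as) = ℕP.⊔-lub a (maxAbs-least fs m as)

maxAbs-attained : ∀ fs → 1 ≤ length fs → Σ ℕ (λ k → k < length fs × ∣ nth fs k ∣ ≡ maxAbsList fs)
maxAbs-attained (x ∷ [])     _ = 0 , s≤s z≤n , sym (ℕP.⊔-identityʳ ∣ x ∣)
maxAbs-attained (x ∷ y ∷ fs) _ with maxAbs-attained (y ∷ fs) (s≤s z≤n) | ℕP.≤-total ∣ x ∣ (maxAbsList (y ∷ fs))
... | k , lt , e | inj₁ le = suc k , s≤s lt , trans e (sym (ℕP.m≤n⇒m⊔n≡n le))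
... | _          | inj₂ ge = 0 , s≤s z≤n , sym (ℕP.m≥n⇒m⊔n≡m ge)

rangeZ : ℕ → List ℤ
rangeZ m = map +_ (upTo (suc m)) ++ map -[1+_] (upTo m)

∈-rangeZ : ∀ m x → ∣ x ∣ ≤ m → x ∈ rangeZ m
∈-rangeZ m (+ k)    le = ∈-++⁺ˡ (∈-map⁺ +_ (∈-upTo⁺ (s≤s le)))
∈-rangeZ m -[1+ k ] le = ∈-++⁺ʳ (map +_ (upTo (suc m))) (∈-map⁺ -[1+_] (∈-upTo⁺ le))

Unique-rangeZ : ∀ m → Unique (rangeZ m)
Unique-rangeZ m = Unique.++⁺ (Unique.map⁺ ℤP.+-injective (Unique.upTo⁺ (suc m)))
                             (Unique.map⁺ ℤP.-[1+-injective (Unique.upTo⁺ m)) disjoint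
  where
  disjoint : ∀ {v} → ¬ (v ∈ map +_ (upTo (suc m)) × v ∈ map -[1+_] (upTo m))
  disjoint (a , b) with ∈-map⁻ +_ a | ∈-map⁻ -[1+_] b
  ... | _ , _ , refl | _ , _ , ()

boundedVecs-suc : ∀ m n → boundedVecs m (suc n) ≡ cartesianProductWith _∷_ (rangeZ m) (boundedVecs m n)
boundedVecs-suc m n = concatMap≡ (rangeZ m)
  where
  concatMap≡ : ∀ xs → concatMap (λ x → map (x ∷_) (boundedVecs m n)) xs ≡ cartesianProductWith _∷_ xs (boundedVecs m n)
  concatMap≡ []       = refl
  concatMap≡ (x ∷ xs) = cong (map (x ∷_) (boundedVecs m n) ++_) (concatMap≡ xs)

∈-boundedVecs : ∀ m n (f : Vec ℤ n) → All (λ x → ∣ x ∣ ≤ m) (toList f) → f ∈ boundedVecs m n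
∈-boundedVecs m zero    []      _        = here refl
∈-boundedVecs m (suc n) (x ∷ f) (a ∷ as) =
  subst (x ∷ f ∈_) (sym (boundedVecs-suc m n))
    (∈-cartesianProductWith⁺ _∷_ (∈-rangeZ m x a) (∈-boundedVecs m n f as))

Unique-boundedVecs : ∀ m n → Unique (boundedVecs m n)
Unique-boundedVecs m zero    = [] ∷ []
Unique-boundedVecs m (suc n) =
  subst Unique (sym (boundedVecs-suc m n))
    (Unique.cartesianProductWith⁺ _∷_ (λ { refl → refl , refl }) (Unique-rangeZ m) (Unique-boundedVecs m n))

pigeonhole : (ys zs : List ℕ) → Unique ys → All (_∈ zs) ys → length ys ≤ length zs
pigeonhole []       zs _          _          = z≤n
pigeonhole (y ∷ ys) zs (y∉ys ∷ u) (y∈zs ∷ a) with ∈-∃++ y∈zs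
... | zs₁ , zs₂ , refl =
  ℕP.≤-trans (s≤s (pigeonhole ys (zs₁ ++ zs₂) u (remove y∉ys a)))
    (ℕP.≤-reflexive (trans (cong suc (length-++ zs₁)) (trans (sym (ℕP.+-suc (length zs₁) (length zs₂))) (sym (length-++ zs₁)))))
  where
  remove : ∀ {ws} → All (λ w → ¬ y ≡ w) ws → All (_∈ zs₁ ++ y ∷ zs₂) ws → All (_∈ zs₁ ++ zs₂) ws
  remove []         []        = []
  remove (ne ∷ nes) (w∈ ∷ ws) with ∈-++⁻ zs₁ w∈
  ... | inj₁ w∈₁         = ∈-++⁺ˡ w∈₁ ∷ remove nes ws
  ... | inj₂ (here refl) = ⊥-elim (ne refl)
  ... | inj₂ (there w∈₂) = ∈-++⁺ʳ zs₁ w∈₂ ∷ remove nes ws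

position : ℕ → List ℤ → ℕ
position k []       = 0
position k (x ∷ xs) = if ∣ x ∣ ≡ᵇ suc k then 0 else suc (position k xs)

position-correct : ∀ k xs → suc k ∈ map ∣_∣ xs → position k xs < length xs × ∣ nth xs (position k xs) ∣ ≡ suc k
position-correct k (x ∷ xs) mem with ∣ x ∣ ≡ᵇ suc k in found
... | true  = s≤s z≤n , ℕP.≡ᵇ⇒≡ ∣ x ∣ (suc k) (subst T (sym found) tt)
... | false with mem
...   | here e    = ⊥-elim (subst T found (ℕP.≡⇒≡ᵇ ∣ x ∣ (suc k) (sym e)))
...   | there mem' with position-correct k xs mem'
...     | lt , e = s≤s lt , e

≡ᵇ-refl : ∀ a → T (a ≡ᵇ a)
≡ᵇ-refl zero    = tt
≡ᵇ-refl (suc a) = ≡ᵇ-refl a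

position-inverse : ∀ xs → Unique (map ∣_∣ xs) → ∀ p → p < length xs → 1 ≤ ∣ nth xs p ∣ →
  position (∣ nth xs p ∣ ∸ 1) xs ≡ p
position-inverse (x ∷ xs) u zero _ ge with ∣ x ∣ | ge
... | suc a | _ with a ≡ᵇ a in eq
...   | true  = refl
...   | false = ⊥-elim (subst T eq (≡ᵇ-refl a))
position-inverse (x ∷ xs) (x∉ ∷ u) (suc p) (s≤s lt) ge with ∣ nth xs p ∣ in ay | ge
... | suc a | _ with ∣ x ∣ ≡ᵇ suc a in eq
...   | true  = ⊥-elim (All.lookup x∉ (subst (_∈ map ∣_∣ xs) ay (∈-map⁺ ∣_∣ (nth∈ xs p lt)))
                                      (ℕP.≡ᵇ⇒≡ ∣ x ∣ (suc a) (subst T (sym eq) tt)))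
...   | false = cong suc (trans (cong (λ z → position (z ∸ 1) xs) (sym ay))
                                (position-inverse xs u p lt (subst (1 ≤_) (sym ay) (s≤s z≤n))))

-- For γ ∈ B_n write x p = γ(p+1), p < n.  The map p ↦ |x p| - 1 is a permutation of
-- [0, n) with inverse k ↦ position k; hence tabulated sequences can be reindexed by it.

module SignedPermutation (n : ℕ) (γ : Vec ℤ n) (inB : InB n γ) where

  xs : List ℤ
  xs = toList γ

  x : ℕ → ℤ
  x p = nth xs p

  length-xs : length xs ≡ n
  length-xs = length-toList γ

  bound : ∀ p → p < n → (1 ≤ ∣ x p ∣) × (∣ x p ∣ ≤ n)
  bound p lt = All.lookup (proj₁ inB) (nth∈ xs p (subst (p <_) (sym length-xs) lt))

  ∣x∣-1<n : ∀ p → p < n → ∣ x p ∣ ∸ 1 < n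
  ∣x∣-1<n p lt with ∣ x p ∣ | bound p lt
  ... | suc a | _ , le = le

  ∈-[1,n] : ∀ {a} → 1 ≤ a → a ≤ n → a ∈ map suc (upTo n)
  ∈-[1,n] {suc b} _ b<n = ∈-map⁺ suc (∈-upTo⁺ b<n)

  in-range : All (_∈ map suc (upTo n)) (map ∣_∣ xs)
  in-range = AllP.map⁺ (All.map (λ (lo , hi) → ∈-[1,n] lo hi) (proj₁ inB))

  covers : ∀ k → k < n → suc k ∈ map ∣_∣ xs
  covers k k<n with suc k ∈? map ∣_∣ xs
  ... | yes k∈ = k∈
  ... | no  k∉ = ⊥-elim (ℕP.1+n≰n (subst₂ _≤_ length-extended length-range
                   (pigeonhole (suc k ∷ map ∣_∣ xs) (map suc (upTo n))
                      (All.tabulate (λ k∈ e → k∉ (subst (_∈ map ∣_∣ xs) (sym e) k∈)) ∷ proj₂ inB)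
                      (∈-[1,n] (s≤s z≤n) k<n ∷ in-range))))
    where
    length-extended : length (suc k ∷ map ∣_∣ xs) ≡ suc n
    length-extended = cong suc (trans (length-map ∣_∣ xs) length-xs)
    length-range : length (map suc (upTo n)) ≡ n
    length-range = trans (length-map suc (upTo n)) (length-upTo n)

  pos : ℕ → ℕ
  pos k = position k xs

  pos-correct : ∀ k → k < n → pos k < n × ∣ x (pos k) ∣ ≡ suc k
  pos-correct k lt with position-correct k xs (covers k lt)
  ... | l , e = subst (pos k <_) length-xs l , e

  pos-inverse : ∀ p → p < n → pos (∣ x p ∣ ∸ 1) ≡ p
  pos-inverse p lt = position-inverse xs (proj₂ inB) p (subst (p <_) (sym length-xs) lt) (proj₁ (bound p lt))

  abs-injective : ∀ p q → p < n → q < n → ∣ x p ∣ ≡ ∣ x q ∣ → p ≡ q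
  abs-injective p q lp lq e = trans (sym (pos-inverse p lp)) (trans (cong (λ z → pos (z ∸ 1)) e) (pos-inverse q lq))

  abs↭ : map ∣_∣ xs ↭ map suc (upTo n)
  abs↭ = ∼bag⇒↭ (unique∧set⇒bag (proj₂ inB) (Unique.map⁺ ℕP.suc-injective (Unique.upTo⁺ n))
           (mk⇔ (All.lookup in-range) from))
    where
    from : ∀ {v} → v ∈ map suc (upTo n) → v ∈ map ∣_∣ xs
    from mem with ∈-map⁻ suc mem
    ... | k , k∈ , refl = covers k (∈-upTo⁻ k∈)

  reindex : ∀ {X : Set} (g : ℕ → X) → applyUpTo g n ↭ applyUpTo (λ p → g (∣ x p ∣ ∸ 1)) n
  reindex {X} g = ↭-trans (↭-reflexive (sym (map-applyUpTo suc g' n)))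
             (↭-trans (↭-reflexive (cong (map g') (sym (map-upTo suc n))))
             (↭-trans (Perm.map⁺ g' (↭-sym abs↭))
                      (↭-reflexive (begin
                        map g' (map ∣_∣ xs)                        ≡⟨ map-∘ xs ⟨
                        map (λ y → g' ∣ y ∣) xs                    ≡⟨ cong (map (λ y → g' ∣ y ∣)) (toList-tabulated γ) ⟩
                        map (λ y → g' ∣ y ∣) (applyUpTo x n)       ≡⟨ map-applyUpTo x (λ y → g' ∣ y ∣) n ⟩
                        applyUpTo (λ p → g (∣ x p ∣ ∸ 1)) n        ∎))))
    where
    g' : ℕ → X
    g' y = g (y ∸ 1)

T-∧⁻ : ∀ a {b} → T (a ∧ b) → T a × T b
T-∧⁻ true t = tt , t

T-and-range⁻ : ∀ (c : ℕ → Bool) k → T (and (map c (map suc (upTo k)))) → ∀ p → p < k → T (c (suc p))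
T-and-range⁻ c k t p lt = AllP.applyUpTo⁻ (λ i → i) k (AllP.map⁻ (AllP.all⁺ c (map suc (upTo k)) t)) lt

T-and-range⁺ : ∀ (c : ℕ → Bool) k → (∀ p → p < k → T (c (suc p))) → T (and (map c (map suc (upTo k))))
T-and-range⁺ c k h = AllP.all⁻ c (AllP.map⁺ (AllP.applyUpTo⁺₁ (λ i → i) k (λ lt → h _ lt)))

-- ε_p = [p ∈ Des_B γ], and the factor (w, ε) = (p, ε_p) contributed by position p.
descentAt : ∀ {n} → Vec ℤ n → ℕ → ℕ
descentAt γ p = if val γ (suc p) <ᶻ val γ p then 1 else 0

descentFactor : ∀ {n} → Vec ℤ n → ℕ → ℕ × ℕ
descentFactor γ p = p , descentAt γ p

descentAt-yes : ∀ a b → a ℤ.< b → (if a <ᶻ b then 1 else 0) ≡ 1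
descentAt-yes a b lt with a ℤ.<? b
... | yes _   = refl
... | no  a≮b = ⊥-elim (a≮b lt)

withSignOf : ℤ → ℕ → ℤ
withSignOf a v = if a <ᶻ + 0 then - (+ v) else + v

∣withSignOf∣ : ∀ a v → ∣ withSignOf a v ∣ ≡ v
∣withSignOf∣ a v with a ℤ.<? + 0
... | yes _ = ℤP.∣-i∣≡∣i∣ (+ v)
... | no  _ = refl

withSignOf-∣∣ : ∀ a z → T ((a <ᶻ + 0) ==ᵇ (z <ᶻ + 0)) → withSignOf a ∣ z ∣ ≡ z
withSignOf-∣∣ a z t with a ℤ.<? + 0 | z ℤ.<? + 0
withSignOf-∣∣ a -[1+ k ] t | yes _ | yes _        = refl
withSignOf-∣∣ a (+ k)    t | yes _ | yes (ℤ.+<+ ())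
withSignOf-∣∣ a (+ k)    t | no  _ | no  _        = refl
withSignOf-∣∣ a -[1+ k ] t | no  _ | no  z≮0      = ⊥-elim (z≮0 ℤ.-<+)

sameSign⇒ : ∀ a z → T ((a <ᶻ + 0) ==ᵇ (z <ᶻ + 0)) → (a ℤ.< + 0 → z ℤ.< + 0) × (z ℤ.< + 0 → a ℤ.< + 0)
sameSign⇒ a z t with a ℤ.<? + 0 | z ℤ.<? + 0
... | yes a<0 | yes z<0 = (λ _ → z<0) , (λ _ → a<0)
... | no  a≮0 | no  z≮0 = (λ a<0 → ⊥-elim (a≮0 a<0)) , (λ z<0 → ⊥-elim (z≮0 z<0))

Unique-map-injectiveOn : ∀ {X Y : Set} (f : X → Y) {xs : List X} →
  (∀ {a b} → a ∈ xs → b ∈ xs → f a ≡ f b → a ≡ b) → Unique xs → Unique (map f xs)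
Unique-map-injectiveOn f inj []            = []
Unique-map-injectiveOn f inj (a∉ ∷ u) =
  distinct a∉ (λ b∈ → inj (here refl) (there b∈)) ∷ Unique-map-injectiveOn f (λ a∈ b∈ → inj (there a∈) (there b∈)) u
  where
  distinct : ∀ {a ys} → All (λ y → ¬ a ≡ y) ys → (∀ {y} → y ∈ ys → f a ≡ f y → a ≡ y) → All (λ y → ¬ f a ≡ y) (map f ys)
  distinct []         _   = []
  distinct (ne ∷ nes) inj = (λ e → ne (inj (here refl) e)) ∷ distinct nes (λ y∈ → inj (there y∈))

count-cong : ∀ {A B : Set} {P : A → Set} {R : B → Set}
  (P? : ∀ a → Dec (P a)) (R? : ∀ b → Dec (R b)) (g : ℕ → A) (h : ℕ → B) k →
  (∀ p → p < k → (P (g p) → R (h p)) × (R (h p) → P (g p))) →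
  length (filter P? (applyUpTo g k)) ≡ length (filter R? (applyUpTo h k))
count-cong P? R? g h zero    e = refl
count-cong P? R? g h (suc k) e with P? (g 0) | R? (h 0)
... | yes _  | yes _  = cong suc (count-cong P? R? (λ i → g (suc i)) (λ i → h (suc i)) k (λ p lt → e (suc p) (s≤s lt)))
... | no  _  | no  _  = count-cong P? R? (λ i → g (suc i)) (λ i → h (suc i)) k (λ p lt → e (suc p) (s≤s lt))
... | yes pg | no ¬rh = ⊥-elim (¬rh (proj₁ (e 0 (s≤s z≤n)) pg))
... | no ¬pg | yes rh = ⊥-elim (¬pg (proj₂ (e 0 (s≤s z≤n)) rh))

suc<n⇒<n∸1 : ∀ {n p} → suc p < n → p < n ∸ 1
suc<n⇒<n∸1 lt = ℕP.∸-monoˡ-≤ 1 lt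

<n∸1⇒suc<n : ∀ {n p} → p < n ∸ 1 → suc p < n
<n∸1⇒suc<n {suc n} lt = s≤s lt

-- The core of the proof, for a fixed γ ∈ B_n (n ≥ 1): the f ∈ ℤⁿ with π(f) = γ,
-- max f = m and m·n - |f| = j correspond bijectively to the admissible sequences
-- d ∈ admissibles (applyUpTo (descentFactor γ) n) m j, via f ↦ differences of λ
-- where λ_p = |f_{|γ(p+1)|}|.

module Window (n : ℕ) (γ : Vec ℤ n) (inB : InB n γ) (n≥1 : 1 ≤ n) where

  open SignedPermutation n γ inB

  F : List ℤ → ℕ → ℤ
  F fs p = nth fs (∣ x p ∣ ∸ 1)

  Λ : List ℤ → ℕ → ℕ
  Λ fs p = ∣ F fs p ∣

  -- Conditions (2) and (3) of π(f) = γ as Booleans, indexed by p = i - 1.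
  signed : List ℤ → ℕ → Bool
  signed fs p = (x p <ᶻ + 0) ==ᵇ (F fs p <ᶻ + 0)

  tieBroken : List ℤ → ℕ → Bool
  tieBroken fs p = not (Λ fs p ≡ᵇ Λ fs (suc p)) ∨ (x p <ᶻ x (suc p))

  record IsPi (fs : List ℤ) : Set where
    field
      ordered≤  : ∀ p → suc p < n → Λ fs p ≤ Λ fs (suc p)
      signs     : ∀ p → p < n → T (signed fs p)
      ties      : ∀ p → suc p < n → T (tieBroken fs p)

  piIs⇒IsPi : ∀ f → T (piIs γ f) → IsPi (toList f)
  piIs⇒IsPi f t with Equivalence.to T-∧ t
  ... | t₁ , t₂₃ with Equivalence.to T-∧ t₂₃
  ... | t₂ , t₃ = record
    { ordered≤ = λ p lt → ℕP.≤ᵇ⇒≤ _ _ (T-and-range⁻ _ (n ∸ 1) t₁ p (suc<n⇒<n∸1 lt))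
    ; signs    = T-and-range⁻ _ n t₂
    ; ties     = λ p lt → T-and-range⁻ _ (n ∸ 1) t₃ p (suc<n⇒<n∸1 lt) }

  IsPi⇒piIs : ∀ f → IsPi (toList f) → T (piIs γ f)
  IsPi⇒piIs f isPi = Equivalence.from T-∧
    ( T-and-range⁺ _ (n ∸ 1) (λ p lt → ℕP.≤⇒≤ᵇ (IsPi.ordered≤ isPi p (<n∸1⇒suc<n lt)))
    , Equivalence.from T-∧ ( T-and-range⁺ _ n (IsPi.signs isPi)
                           , T-and-range⁺ _ (n ∸ 1) (λ p lt → IsPi.ties isPi p (<n∸1⇒suc<n lt))))

  Adm : List ℕ → ℕ → ℕ → Set
  Adm = Admissible (descentFactor γ) n

  -- From sequences to vectors: φ d has f_{|γ(p+1)|} = ±(d_0 + … + d_p), signed like γ(p+1).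
  entryOf : List ℕ → ℕ → ℤ
  entryOf d k = withSignOf (x (pos k)) (prefix d (suc (pos k)))

  φ : List ℕ → Vec ℤ n
  φ d = vecOf n (entryOf d)

  nth-φ : ∀ d k → k < n → nth (toList (φ d)) k ≡ entryOf d k
  nth-φ d k lt = trans (cong (λ z → nth z k) (toList-vecOf n (entryOf d))) (nth-applyUpTo (entryOf d) n k lt)

  F-φ : ∀ d p → p < n → F (toList (φ d)) p ≡ withSignOf (x p) (prefix d (suc p))
  F-φ d p lt = trans (nth-φ d (∣ x p ∣ ∸ 1) (∣x∣-1<n p lt))
                     (cong (λ q → withSignOf (x q) (prefix d (suc q))) (pos-inverse p lt))

  Λ-φ : ∀ d p → p < n → Λ (toList (φ d)) p ≡ prefix d (suc p)
  Λ-φ d p lt = trans (cong ∣_∣ (F-φ d p lt)) (∣withSignOf∣ (x p) (prefix d (suc p)))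

  -- If γ(p+1) < 0 then λ_p ≥ 1: going back from p+1 to the start of the run of
  -- negative entries of γ containing it, we meet a descent q ≤ p, where d_q ≥ 1.
  negative⇒prefix-pos : ∀ {d m j} → Adm d m j → ∀ p → p < n → x p ℤ.< + 0 → 1 ≤ prefix d (suc p)
  negative⇒prefix-pos {d} adm zero lt neg =
    subst (1 ≤_) (sym (prefix-suc d 0)) (subst (_≤ entry d 0) (descentAt-yes (x 0) (+ 0) neg) (Admissible.lower adm 0 lt))
  negative⇒prefix-pos {d} adm (suc q) lt neg with x q ℤ.<? + 0
  ... | yes negq = ℕP.≤-trans (negative⇒prefix-pos adm q (ℕP.<-trans (ℕP.n<1+n q) lt) negq) (prefix-mono d (suc q))
  ... | no  x≥0  =
    subst (1 ≤_) (sym (prefix-suc d (suc q)))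
      (ℕP.≤-trans (subst (_≤ entry d (suc q)) (descentAt-yes (x (suc q)) (x q) (ℤP.<-≤-trans neg (ℤP.≮⇒≥ x≥0)))
                                             (Admissible.lower adm (suc q) lt))
                  (ℕP.m≤n+m (entry d (suc q)) (prefix d (suc q))))

  IsPi-φ : ∀ {d m j} → Adm d m j → IsPi (toList (φ d))
  IsPi-φ {d} adm = record
    { ordered≤ = λ p lt → subst₂ _≤_ (sym (Λ-φ d p (ℕP.<-trans (ℕP.n<1+n p) lt))) (sym (Λ-φ d (suc p) lt)) (prefix-mono d (suc p))
    ; signs    = λ p lt → subst (λ z → T ((x p <ᶻ + 0) ==ᵇ (z <ᶻ + 0))) (sym (F-φ d p lt))
                                (signed-φ (x p) (prefix d (suc p)) (negative⇒prefix-pos adm p lt))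
    ; ties     = ties }
    where
    signed-φ : ∀ a v → (a ℤ.< + 0 → 1 ≤ v) → T ((a <ᶻ + 0) ==ᵇ (withSignOf a v <ᶻ + 0))
    signed-φ a v h with a ℤ.<? + 0
    ... | no  _ = tt
    ... | yes neg with v | h neg
    ...   | suc _ | _ = tt
    -- equal λ_p = λ_{p+1} forces d_{p+1} = 0, so p+1 is no descent, so γ(p+1) < γ(p+2).
    ties : ∀ p → suc p < n → T (tieBroken (toList (φ d)) p)
    ties p lt rewrite Λ-φ d p (ℕP.<-trans (ℕP.n<1+n p) lt) | Λ-φ d (suc p) lt
      with prefix d (suc p) ≡ᵇ prefix d (suc (suc p)) in eq
    ... | false = tt
    ... | true  = fromWitness (ℤP.≤∧≢⇒< (ℤP.≮⇒≥ no-descent) distinct)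
      where
      d₀ : entry d (suc p) ≡ 0
      d₀ = ℕP.+-cancelˡ-≡ (prefix d (suc p)) (entry d (suc p)) 0
             (trans (sym (trans (ℕP.≡ᵇ⇒≡ _ _ (subst T (sym eq) tt)) (prefix-suc d (suc p))))
                    (sym (ℕP.+-identityʳ (prefix d (suc p)))))
      no-descent : ¬ x (suc p) ℤ.< x p
      no-descent l with ℕP.≤-trans (ℕP.≤-reflexive (sym (descentAt-yes (x (suc p)) (x p) l)))
                         (subst (descentAt γ (suc p) ≤_) d₀ (Admissible.lower adm (suc p) lt))
      ... | ()
      distinct : ¬ x p ≡ x (suc p)
      distinct e = ℕP.1+n≢n (sym (abs-injective p (suc p) (ℕP.<-trans (ℕP.n<1+n p) lt) lt (cong ∣_∣ e)))

  last : ℕ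
  last = n ∸ 1

  suc-last : suc last ≡ n
  suc-last = trans (ℕP.+-comm 1 (n ∸ 1)) (ℕP.m∸n+n≡m n≥1)

  last<n : last < n
  last<n = subst (last <_) suc-last (ℕP.n<1+n last)

  absSum-Λ : ∀ fs → length fs ≡ n → sum (map ∣_∣ fs) ≡ sum (applyUpTo (Λ fs) n)
  absSum-Λ fs l = begin
    sum (map ∣_∣ fs)                                   ≡⟨ cong (λ z → sum (map ∣_∣ z)) (trans (applyUpTo-nth fs) (cong (applyUpTo (nth fs)) l)) ⟩
    sum (map ∣_∣ (applyUpTo (nth fs) n))               ≡⟨ cong sum (map-applyUpTo (nth fs) ∣_∣ n) ⟩
    sum (applyUpTo (λ k → ∣ nth fs k ∣) n)             ≡⟨ sum-↭ (reindex (λ k → ∣ nth fs k ∣)) ⟩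
    sum (applyUpTo (Λ fs) n)                           ∎

  -- every entry of φ d is bounded by λ_{n-1} = Σ d = m.
  entries-φ≤ : ∀ {d m j} → Adm d m j → All (λ z → ∣ z ∣ ≤ m) (toList (φ d))
  entries-φ≤ {d} {m} adm = subst (All (λ z → ∣ z ∣ ≤ m)) (sym (toList-vecOf n (entryOf d)))
    (AllP.applyUpTo⁺₁ (entryOf d) n (λ {k} _ → subst (_≤ m) (sym (∣withSignOf∣ (x (pos k)) _))
       (subst (prefix d (suc (pos k)) ≤_) (Admissible.sum≡ adm) (prefix≤sum d (suc (pos k))))))

  maxAbs-φ : ∀ {d m j} → Adm d m j → maxAbs (φ d) ≡ m
  maxAbs-φ {d} {m} adm = ℕP.≤-antisym
    (maxAbs-least (toList (φ d)) m (entries-φ≤ adm))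
    (subst (_≤ maxAbs (φ d)) top
       (All.lookup (maxAbs-upper (toList (φ d))) (nth∈ (toList (φ d)) k₀ (subst (k₀ <_) (sym (length-toList (φ d))) (∣x∣-1<n last last<n)))))
    where
    k₀ : ℕ
    k₀ = ∣ x last ∣ ∸ 1
    top : Λ (toList (φ d)) last ≡ m
    top = begin
      Λ (toList (φ d)) last         ≡⟨ Λ-φ d last last<n ⟩
      prefix d (suc last)           ≡⟨ cong (prefix d) (trans suc-last (sym (Admissible.length≡ adm))) ⟩
      prefix d (length d)           ≡⟨ prefix-length d ⟩
      sum d                         ≡⟨ Admissible.sum≡ adm ⟩
      m                             ∎

  absSum-φ : ∀ d → absSum (φ d) ≡ sum (applyUpTo (λ p → prefix d (suc p)) n)
  absSum-φ d = trans (absSum-Λ (toList (φ d)) (length-toList (φ d)))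
                     (cong sum (applyUpTo-cong _ _ n (Λ-φ d)))

  weight-φ : ∀ {d m j} → Adm d m j → m ℕ.* n ∸ absSum (φ d) ≡ j
  weight-φ {d} {m} {j} adm = begin
    m ℕ.* n ∸ absSum (φ d)                                   ≡⟨ cong (m ℕ.* n ∸_) (absSum-φ d) ⟩
    m ℕ.* n ∸ sum (applyUpTo (λ p → prefix d (suc p)) n)     ≡⟨ levels-weight d n m (Admissible.length≡ adm) (Admissible.sum≡ adm) ⟩
    indexWeighted 0 d                                        ≡⟨ weightedSum≡indexWeighted _ 0 n d (λ p → refl) (Admissible.length≡ adm) ⟨
    weightedSum (descentFactor γ) n d                        ≡⟨ Admissible.weighted≡ adm ⟩
    j                                                        ∎

  -- φ d has its negative entries exactly where γ has, so as many of them.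
  negCount-φ : ∀ {d m j} → Adm d m j → negCount (toList (φ d)) ≡ negCount xs
  negCount-φ {d} adm = begin
    length (filter neg? (toList (φ d)))                                  ≡⟨ cong (λ z → length (filter neg? z)) (toList-vecOf n (entryOf d)) ⟩
    length (filter neg? (applyUpTo (entryOf d) n))                       ≡⟨ Perm.↭-length (Perm.filter-↭ neg? (reindex (entryOf d))) ⟩
    length (filter neg? (applyUpTo (λ p → entryOf d (∣ x p ∣ ∸ 1)) n))  ≡⟨ count-cong neg? neg? _ x n same-sign ⟩
    length (filter neg? (applyUpTo x n))                                 ≡⟨ cong (λ z → length (filter neg? z)) (toList-tabulated γ) ⟨
    length (filter neg? xs)                                              ∎
    where
    neg? : ∀ z → Dec (z ℤ.< + 0)
    neg? z = z ℤ.<? + 0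
    same-sign : ∀ p → p < n → (entryOf d (∣ x p ∣ ∸ 1) ℤ.< + 0 → x p ℤ.< + 0) × (x p ℤ.< + 0 → entryOf d (∣ x p ∣ ∸ 1) ℤ.< + 0)
    same-sign p lt with sameSign⇒ (x p) _ (subst (λ z → T ((x p <ᶻ + 0) ==ᵇ (z <ᶻ + 0))) (nth-φ d _ (∣x∣-1<n p lt))
                                             (IsPi.signs (IsPi-φ adm) p lt))
    ... | to , from = from , to

  Q : ℕ → ℕ → Vec ℤ n → Bool
  Q m j f = (maxAbs f ≡ᵇ m) ∧ evenNeg f ∧ piIs γ f ∧ ((m ℕ.* n ∸ absSum f) ≡ᵇ j)

  Q-φ : negCount xs % 2 ≡ 0 → ∀ {d m j} → Adm d m j → T (Q m j (φ d))
  Q-φ even {d} {m} {j} adm =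
    Equivalence.from T-∧ (subst (λ z → T (z ≡ᵇ m)) (sym (maxAbs-φ adm)) (≡ᵇ-refl m) ,
    Equivalence.from T-∧ (subst (λ z → T ((z % 2) ≡ᵇ 0)) (sym (negCount-φ adm)) (subst (λ z → T (z ≡ᵇ 0)) (sym even) tt) ,
    Equivalence.from T-∧ (IsPi⇒piIs (φ d) (IsPi-φ adm) ,
                          subst (λ z → T (z ≡ᵇ j)) (sym (weight-φ adm)) (≡ᵇ-refl j))))

  ψ : Vec ℤ n → List ℕ
  ψ f = differences 0 (Λ (toList f)) n

  module Selected {m j : ℕ} (f : Vec ℤ n) (q : T (Q m j f)) where

    fs : List ℤ
    fs = toList f

    L : ℕ → ℕ
    L = Λ fs

    max≡ : maxAbs f ≡ m
    max≡ = ℕP.≡ᵇ⇒≡ _ _ (proj₁ (T-∧⁻ (maxAbs f ≡ᵇ m) q))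

    isPi : IsPi fs
    isPi = piIs⇒IsPi f (proj₁ (T-∧⁻ (piIs γ f) (proj₂ (T-∧⁻ (evenNeg f) (proj₂ (T-∧⁻ (maxAbs f ≡ᵇ m) q))))))

    weight≡ : m ℕ.* n ∸ absSum f ≡ j
    weight≡ = ℕP.≡ᵇ⇒≡ _ _ (proj₂ (T-∧⁻ (piIs γ f) (proj₂ (T-∧⁻ (evenNeg f) (proj₂ (T-∧⁻ (maxAbs f ≡ᵇ m) q))))))

    monotone : ∀ p p' → p ≤ p' → p' < n → L p ≤ L p'
    monotone p p' le lt with ℕP.m≤n⇒∃[o]m+o≡n le
    ... | k , refl = chain k lt
      where
      chain : ∀ k → p ℕ.+ k < n → L p ≤ L (p ℕ.+ k)
      chain zero    lt rewrite ℕP.+-identityʳ p = ℕP.≤-refl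
      chain (suc k) lt rewrite ℕP.+-suc p k =
        ℕP.≤-trans (chain k (ℕP.<-trans (ℕP.n<1+n (p ℕ.+ k)) lt)) (IsPi.ordered≤ isPi (p ℕ.+ k) lt)

    prefix-ψ : ∀ p → p < n → prefix (ψ f) (suc p) ≡ L p
    prefix-ψ p lt = trans (sym (ℕP.+-identityʳ _)) (prefix-differences 0 L n z≤n (IsPi.ordered≤ isPi) p lt)

    L-last : L last ≡ m
    L-last = ℕP.≤-antisym
      (subst (L last ≤_) max≡ (All.lookup (maxAbs-upper fs) (nth∈ fs (∣ x last ∣ ∸ 1) (subst (_ <_) (sym (length-toList f)) (∣x∣-1<n last last<n)))))
      (subst (_≤ L last) max≡ max≤)
      where
      max≤ : maxAbsList fs ≤ L last
      max≤ with maxAbs-attained fs (subst (1 ≤_) (sym (length-toList f)) n≥1)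
      ... | k , k<len , e with pos-correct k (subst (k <_) (length-toList f) k<len)
      ...   | p<n , ∣x∣≡ = subst (_≤ L last) (trans (cong (λ z → ∣ nth fs (z ∸ 1) ∣) ∣x∣≡) e)
                             (monotone (pos k) last (ℕP.≤-pred (subst (pos k <_) (sym suc-last) p<n)) last<n)

    lower : ∀ p → p < n → descentAt γ p ≤ difference 0 L p
    lower zero lt with x 0 ℤ.<? + 0
    ... | no  _   = z≤n
    ... | yes neg = neg⇒1≤∣∣ (F fs 0) (proj₁ (sameSign⇒ (x 0) (F fs 0) (IsPi.signs isPi 0 lt)) neg)
      where
      neg⇒1≤∣∣ : ∀ z → z ℤ.< + 0 → 1 ≤ ∣ z ∣
      neg⇒1≤∣∣ -[1+ k ] _         = s≤s z≤n
      neg⇒1≤∣∣ (+ k)    (ℤ.+<+ ())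
    lower (suc p) lt with x (suc p) ℤ.<? x p
    ... | no  _       = z≤n
    ... | yes descent = ℕP.m<n⇒0<n∸m (ℕP.≤∧≢⇒< (IsPi.ordered≤ isPi p lt) strict)
      where
      -- at a descent of γ the tie-breaking condition forbids λ_p = λ_{p+1}.
      strict : ¬ L p ≡ L (suc p)
      strict e with Equivalence.to T-∨ (IsPi.ties isPi p lt)
      ... | inj₁ t = subst (λ b → T (not b)) (trans (cong (_≡ᵇ L (suc p)) e) (T⇒≡true (≡ᵇ-refl (L (suc p))))) t
        where
        T⇒≡true : ∀ {b} → T b → b ≡ true
        T⇒≡true {true} _ = refl
      ... | inj₂ t = ℤP.<-asym descent (toWitness t)

    ψ-admissible : Adm (ψ f) m j
    ψ-admissible = record
      { length≡   = length-differences 0 L n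
      ; lower     = λ p lt → subst (descentAt γ p ≤_) (sym (entry-differences 0 L n p lt)) (lower p lt)
      ; sum≡      = sum≡
      ; weighted≡ = begin
          weightedSum (descentFactor γ) n (ψ f)                        ≡⟨ weightedSum≡indexWeighted _ 0 n (ψ f) (λ p → refl) (length-differences 0 L n) ⟩
          indexWeighted 0 (ψ f)                                        ≡⟨ levels-weight (ψ f) n m (length-differences 0 L n) sum≡ ⟨
          m ℕ.* n ∸ sum (applyUpTo (λ p → prefix (ψ f) (suc p)) n)     ≡⟨ cong (m ℕ.* n ∸_) (trans (cong sum (applyUpTo-cong _ _ n prefix-ψ))
                                                                                                 (sym (absSum-Λ fs (length-toList f)))) ⟩
          m ℕ.* n ∸ absSum f                                           ≡⟨ weight≡ ⟩
          j                                                            ∎ }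
      where
      sum≡ : sum (ψ f) ≡ m
      sum≡ = begin
        sum (ψ f)                        ≡⟨ prefix-length (ψ f) ⟨
        prefix (ψ f) (length (ψ f))      ≡⟨ cong (prefix (ψ f)) (trans (length-differences 0 L n) (sym suc-last)) ⟩
        prefix (ψ f) (suc last)          ≡⟨ prefix-ψ last last<n ⟩
        L last                           ≡⟨ L-last ⟩
        m                                ∎

    φψ : φ (ψ f) ≡ f
    φψ = trans (sym (cast-is-id refl (φ (ψ f)))) (toList-injective refl (φ (ψ f)) f
           (trans (toList-vecOf n (entryOf (ψ f))) (trans (applyUpTo-cong _ _ n coordinate) (sym (toList-tabulated f)))))
      where
      coordinate : ∀ k → k < n → entryOf (ψ f) k ≡ nth fs k
      coordinate k lt with pos-correct k lt
      ... | p<n , ∣x∣≡ = begin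
        withSignOf (x (pos k)) (prefix (ψ f) (suc (pos k)))   ≡⟨ cong (withSignOf (x (pos k))) (trans (prefix-ψ (pos k) p<n) (cong (λ z → ∣ nth fs (z ∸ 1) ∣) ∣x∣≡)) ⟩
        withSignOf (x (pos k)) ∣ nth fs k ∣                   ≡⟨ withSignOf-∣∣ (x (pos k)) (nth fs k)
                                                                   (subst (λ z → T ((x (pos k) <ᶻ + 0) ==ᵇ (nth fs (z ∸ 1) <ᶻ + 0))) ∣x∣≡ (IsPi.signs isPi (pos k) p<n)) ⟩
        nth fs k                                              ∎

  factors : List (ℕ × ℕ)
  factors = applyUpTo (descentFactor γ) n

  -- For γ ∈ D_n, the coefficient (m, j) of the left-hand side counts the admissible sequences:
  -- φ is a bijection between them and the selected vectors (ψ inverts it).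
  lhs≡countSeries : negCount xs % 2 ≡ 0 → ∀ m j → lhsSeries n γ m j ≡ countSeries factors m j
  lhs≡countSeries even m j = begin
    + length selected                             ≡⟨ cong +_ (Perm.↭-length (∼bag⇒↭ (unique∧set⇒bag unique-selected unique-image (mk⇔ to from)))) ⟩
    + length (map φ (admissibles factors m j))    ≡⟨ cong +_ (length-map φ (admissibles factors m j)) ⟩
    + length (admissibles factors m j)            ≡⟨ length-admissibles factors m j ⟩
    countSeries factors m j                       ∎
    where
    Q? : ∀ f → Dec (T (Q m j f))
    Q? f = T? (Q m j f)
    selected : List (Vec ℤ n)
    selected = filterᵇ (Q m j) (boundedVecs m n)
    adm : ∀ {d} → d ∈ admissibles factors m j → Adm d m j
    adm = ∈-admissibles⁻ (descentFactor γ) n m j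
    unique-selected : Unique selected
    unique-selected = Unique.filter⁺ Q? (Unique-boundedVecs m n)
    unique-image : Unique (map φ (admissibles factors m j))
    unique-image = Unique-map-injectiveOn φ
      (λ {d} {d'} d∈ d'∈ e → prefix-injective n d d' (Admissible.length≡ (adm d∈)) (Admissible.length≡ (adm d'∈))
         (λ p lt → trans (sym (Λ-φ d p lt)) (trans (cong (λ v → Λ (toList v) p) e) (Λ-φ d' p lt))))
      (Unique-admissibles factors m j)
    to : ∀ {f} → f ∈ selected → f ∈ map φ (admissibles factors m j)
    to {f} f∈ with ∈-filter⁻ Q? {xs = boundedVecs m n} f∈
    ... | _ , q = subst (_∈ map φ (admissibles factors m j)) (Selected.φψ f q)
                    (∈-map⁺ φ (∈-admissibles⁺ (descentFactor γ) n m j (Selected.ψ-admissible f q)))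
    from : ∀ {f} → f ∈ map φ (admissibles factors m j) → f ∈ selected
    from f∈ with ∈-map⁻ φ f∈
    ... | d , d∈ , refl = ∈-filter⁺ Q? (∈-boundedVecs m n (φ d) (entries-φ≤ (adm d∈))) (Q-φ even (adm d∈))

module _ {Q : ℕ → Set} (Q? : ∀ i → Dec (Q i)) where

  indicatorFactor : (ℕ → ℕ) → ℕ → ℕ × ℕ
  indicatorFactor h p = h p , (if ⌊ Q? (h p) ⌋ then 1 else 0)

  sum-filter≡Σwε : ∀ k h → sum (filter Q? (applyUpTo h k)) ≡ Σwε (applyUpTo (indicatorFactor h) k)
  sum-filter≡Σwε zero    h = refl
  sum-filter≡Σwε (suc k) h with Q? (h 0)
  ... | yes _ = cong₂ ℕ._+_ (sym (ℕP.*-identityʳ (h 0))) (sum-filter≡Σwε k (λ p → h (suc p)))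
  ... | no  _ = trans (sum-filter≡Σwε k (λ p → h (suc p))) (sym (cong (ℕ._+ Σwε (applyUpTo (indicatorFactor (λ p → h (suc p))) k)) (ℕP.*-zeroʳ (h 0))))

  length-filter≡Σε : ∀ k h → length (filter Q? (applyUpTo h k)) ≡ Σε (applyUpTo (indicatorFactor h) k)
  length-filter≡Σε zero    h = refl
  length-filter≡Σε (suc k) h with Q? (h 0)
  ... | yes _ = cong suc (length-filter≡Σε k (λ p → h (suc p)))
  ... | no  _ = length-filter≡Σε k (λ p → h (suc p))

maj≡Σwε : ∀ n (γ : Vec ℤ n) → maj γ ≡ Σwε (applyUpTo (descentFactor γ) n)
maj≡Σwε n γ = sum-filter≡Σwε (λ i → val γ (suc i) ℤ.<? val γ i) n (λ p → p)

desB≡Σε : ∀ n (γ : Vec ℤ n) → length (DesB γ) ≡ Σε (applyUpTo (descentFactor γ) n)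
desB≡Σε n γ = length-filter≡Σε (λ i → val γ (suc i) ℤ.<? val γ i) n (λ p → p)

tail-descents : ∀ {n} (γ : Vec ℤ n) k →
  length (filter (λ i → valD γ (suc i) ℤ.<? valD γ i) (applyUpTo suc k))
  ≡ length (filter (λ i → val γ (suc i) ℤ.<? val γ i) (applyUpTo suc k))
tail-descents γ k = count-cong _ _ suc suc k (λ p _ → (λ d → d) , (λ d → d))

nonzero : ∀ z → 1 ≤ ∣ z ∣ → ¬ z ℤ.< + 0 → ¬ + 0 ℤ.< z → ⊥
nonzero (+ suc z) _ _   0≮z = 0≮z (ℤ.+<+ (s≤s z≤n))
nonzero -[1+ z ]  _ z≮0 _   = z≮0 ℤ.-<+

-- The exponent of t in D_n^γ is des_B γ: Des_D γ and Des_B γ differ only in whether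
-- they contain 0, and the three cases D_n^+, D_n^-, D_n^0 compensate exactly for that.
Dgamma-exponent : ∀ n → 2 ≤ n → (γ : Vec ℤ n) → All (λ x → (1 ≤ ∣ x ∣) × (∣ x ∣ ≤ n)) (toList γ) →
  (if inDplus γ then suc (desD γ) else if inDminus γ then desD γ ∸ 1 else desD γ) ≡ length (DesB γ)
Dgamma-exponent (suc (suc k)) (s≤s (s≤s _)) (x₁ ∷ x₂ ∷ γ') ((1≤∣x₁∣ , _) ∷ _)
  with x₁ ℤ.<? - x₂ | x₁ ℤ.<? + 0 | + 0 ℤ.<? x₁
... | _     | yes x₁<0 | yes 0<x₁ = ⊥-elim (ℤP.<-asym x₁<0 0<x₁)
... | yes _ | yes _    | no  _    = cong suc (tail-descents (x₁ ∷ x₂ ∷ γ') (suc k))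
... | yes _ | no  _    | yes _    = tail-descents (x₁ ∷ x₂ ∷ γ') (suc k)
... | yes _ | no  x₁≮0 | no  0≮x₁ = ⊥-elim (nonzero x₁ 1≤∣x₁∣ x₁≮0 0≮x₁)
... | no  _ | yes _    | _        = cong suc (tail-descents (x₁ ∷ x₂ ∷ γ') (suc k))
... | no  _ | no  _    | _        = tail-descents (x₁ ∷ x₂ ∷ γ') (suc k)

lemma6p2 : (n : ℕ) → 2 ≤ n → (γ : Vec ℤ n) → InD n γ →
    (a b : ℕ) → (lhsSeries n γ ⋆ tqPoch n) a b ≡ Dgamma γ a b
lemma6p2 n n≥2 γ (inB , even) a b = begin
  (lhsSeries n γ ⋆ tqPoch n) a b                            ≡⟨ ⋆-congˡ (tqPoch n) (W.lhs≡countSeries even) a b ⟩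
  (countSeries W.factors ⋆ poch (upTo n)) a b               ≡⟨ cong (λ ws → (countSeries W.factors ⋆ poch ws) a b) weights ⟨
  (countSeries W.factors ⋆ poch (map proj₁ W.factors)) a b  ≡⟨ countSeries-⋆-poch W.factors 0 0 a b ⟩
  mono (Σε W.factors) (Σwε W.factors) a b                   ≡⟨ cong₂ (λ u v → mono u v a b) exponent (maj≡Σwε n γ) ⟨
  Dgamma γ a b                                              ∎
  where
  module W = Window n γ inB (ℕP.≤-trans (s≤s z≤n) n≥2)
  weights : map proj₁ W.factors ≡ upTo n
  weights = map-applyUpTo (descentFactor γ) proj₁ n
  exponent : (if inDplus γ then suc (desD γ) else if inDminus γ then desD γ ∸ 1 else desD γ) ≡ Σε W.factors
  exponent = trans (Dgamma-exponent n n≥2 γ (proj₁ inB)) (desB≡Σε n γ)
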